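{- For $n\ge 4$ let $t_n$ be the number of coherent lattice paths of size $n$ whose last enhanced step is $(x\to n;n-1)$ for some $x$; let $q_n$ be the number of coherent lattice paths of size $n$ whose last enhanced steps are $(x\to n;y_1),(y_1\to y_2;n),\dots,(y_{m-1}\to n-1;n)$ with $m\ge 3$; and let $c_n$ be the number of coherent lattice paths of size $n$ whose last enhanced steps are $(x\to n;y),(y\to n-1;n)$. Then $(t_4,q_4,c_4)=(3,1,4)$ and for all $n\ge4$, $$\begin{pmatrix}t_{n+1}\\ q_{n+1}\\ c_{n+1}\end{pmatrix}=\begin{pmatrix}1&2&2\\0&2&1\\2&0&2\end{pmatrix}\begin{pmatrix}t_n\\ q_n\\ c_n\end{pmatrix}.$$
   Context: A diagonal-avoiding lattice path of size $n$ (dimension 2) is a sequence of points $\boldsymbol\ell_1,\dots,\boldsymbol\ell_r\in[n]^2$ with $\boldsymbol\ell_1=(2,1)$, $\boldsymbol\ell_r\in\{(n-1,n),(n,n-1)\}$, the two coordinates of each point distinct, and consecutive points differing in exactly one coordinate, which strictly increases. Its $i$-th enhanced step is $(a\to b;z)$ where the changing coordinate goes from $a$ to $b$ and the fixed coordinate equals $z$; $\prec$ denotes the order of steps along the path. It is a coherent lattice path if for all enhanced steps $(i\to j;a)\prec(x\to y;z)$ with $x<j$ one has $j=z$ or $x=a$. (Coherent lattice paths of size $n$ correspond bijectively to coherent monotone paths on the hypersimplex $\Delta(n,2)$, i.e. vertices of its monotone path polytope.) -}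

module Defs where

open import Data.Nat using (ℕ; zero; suc; _+_; _∸_; _≤_; _<_; _≡ᵇ_)
open import Data.Bool using (if_then_else_)
open import Data.Product using (_×_; _,_; Σ; ∃-syntax)
open import Data.Sum using (_⊎_)
open import Data.List using (List; []; _∷_; _++_; [_]; length)
open import Data.List.Relation.Unary.All using (All)
open import Data.List.Relation.Unary.Unique.Propositional using (Unique)
open import Data.List.Membership.Propositional using (_∈_)
open import Relation.Binary.PropositionalEquality using (_≡_; _≢_)
open import Relation.Nullary using (¬_)

Point : Set
Point = ℕ × ℕ

-- An enhanced step (a → b ; z) is represented as the triple (a , b , z).
EStep : Set
EStep = ℕ × ℕ × ℕ

ValidPoint : ℕ → Point → Set
ValidPoint n (x , y) = (1 ≤ x × x ≤ n) × (1 ≤ y × y ≤ n) × x ≢ y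

ValidMove : Point → Point → Set
ValidMove (x₁ , y₁) (x₂ , y₂) = (x₁ ≡ x₂ × y₁ < y₂) ⊎ (y₁ ≡ y₂ × x₁ < x₂)

ValidMoves : List Point → Set
ValidMoves [] = Data.Unit.⊤ where import Data.Unit
ValidMoves (p ∷ []) = Data.Unit.⊤ where import Data.Unit
ValidMoves (p ∷ p' ∷ ps) = ValidMove p p' × ValidMoves (p' ∷ ps)

enh : Point → Point → EStep
enh (x₁ , y₁) (x₂ , y₂) = if x₁ ≡ᵇ x₂ then (y₁ , y₂ , x₁) else (x₁ , x₂ , y₁)

steps : List Point → List EStep
steps [] = []
steps (p ∷ []) = []
steps (p ∷ p' ∷ ps) = enh p p' ∷ steps (p' ∷ ps)

LatticePath : ℕ → List Point → Set
LatticePath n ps =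
  (∃[ rest ] ps ≡ (2 , 1) ∷ rest)
  × (∃[ ini ] ∃[ ℓ ] ps ≡ ini ++ [ ℓ ] × (ℓ ≡ (n ∸ 1 , n) ⊎ ℓ ≡ (n , n ∸ 1)))
  × All (ValidPoint n) ps
  × ValidMoves ps

Coherent : List EStep → Set
Coherent ss = ∀ (pre mid post : List EStep) (i j a x y z : ℕ) →
  ss ≡ pre ++ ((i , j , a) ∷ mid ++ ((x , y , z) ∷ post)) →
  x < j → (j ≡ z ⊎ x ≡ a)

CoherentLatticePath : ℕ → List Point → Set
CoherentLatticePath n ps = LatticePath n ps × Coherent (steps ps)

chain : ℕ → List ℕ → ℕ → List EStep
chain z [] e = []
chain z (y ∷ []) e = (y , e , z) ∷ []
chain z (y ∷ y' ∷ ys) e = (y , y' , z) ∷ chain z (y' ∷ ys) e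

IsT : ℕ → List Point → Set
IsT n ps = CoherentLatticePath n ps ×
  (∃[ pre ] ∃[ x ] steps ps ≡ pre ++ [ (x , n , n ∸ 1) ])

IsQ : ℕ → List Point → Set
IsQ n ps = CoherentLatticePath n ps ×
  (∃[ pre ] ∃[ x ] ∃[ y₁ ] ∃[ y₂ ] ∃[ ys ]
     steps ps ≡ pre ++ ((x , n , y₁) ∷ chain n (y₁ ∷ y₂ ∷ ys) (n ∸ 1)))

IsC : ℕ → List Point → Set
IsC n ps = CoherentLatticePath n ps ×
  (∃[ pre ] ∃[ x ] ∃[ y ] steps ps ≡ pre ++ ((x , n , y) ∷ (y , n ∸ 1 , n) ∷ []))

HasCount : {A : Set} → (A → Set) → ℕ → Set
HasCount {A} P k = Σ (List A) λ L →
  Unique L × (∀ a → (P a → a ∈ L) × (a ∈ L → P a)) × length L ≡ k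

-- A coherent path of size n either ends with a step (x → n ; n-1) (type t), or reaches its
-- endpoint along the line on which one coordinate equals n, after one step on that line (type c)
-- or more (type q).  The matrix records eight injective constructions of paths of size n + 1
-- from paths of size n, whose images partition the three types of size n + 1.  A t-path arises
-- by appending the step (n-1 → n+1 ; n) to any path, or by retargeting to n + 1 the last step
-- of a q- or c-path; a q-path by inserting a fresh value n into a q- or c-path and appending
-- (n-1 → n ; n+1), or by inserting a fresh value n - 1 into a q-path; a c-path by turning
-- through a new corner at the end of a t-path, or at the second to last point of a c-path,
-- keeping or dropping the point passed.  Conversely the last points of a coherent path of size
-- n + 1 tell which construction to undo.  Undoing an insertion needs the removed value to be
-- unused earlier: if a path runs along a line through consecutive steps (y′ → y ; z) and
-- (y → a ; z), coherence forces every earlier step that ends beyond y to end at z.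

module Submission where

open import Defs
open import Data.Bool using (Bool; true; false; not; if_then_else_)
open import Data.Empty using (⊥; ⊥-elim)
open import Data.List using (List; []; _∷_; _++_; _∷ʳ_; length; map; reverse)
import Data.List.Properties as List
open import Data.List.Membership.Propositional using (_∈_)
import Data.List.Membership.Propositional.Properties as ∈
open import Data.List.Relation.Unary.All as All using (All; []; _∷_)
import Data.List.Relation.Unary.All.Properties as All
open import Data.List.Relation.Unary.AllPairs as AllPairs using (AllPairs; []; _∷_)
import Data.List.Relation.Unary.AllPairs.Properties as AllPairs
open import Data.List.Relation.Unary.Any using (here)
import Data.List.Relation.Unary.Any.Properties as Any
open import Data.List.Relation.Unary.Unique.Propositional using (Unique)
import Data.List.Relation.Unary.Unique.Propositional.Properties as Unique
open import Data.Nat using (ℕ; zero; suc; pred; _+_; _*_; _∸_; _≤_; _<_; _<ᵇ_; _≡ᵇ_; z≤n; s≤s)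
open import Data.Nat.Properties
open import Data.Nat.Tactic.RingSolver using (solve-∀)
open import Data.Product as Product using (_×_; _,_; proj₁; proj₂; Σ-syntax; ∃-syntax)
open import Data.Sum as Sum using (_⊎_; inj₁; inj₂; [_,_])
open import Data.Unit using (tt)
open import Function using (_∘_; flip)
open import Relation.Binary.PropositionalEquality hiding ([_])
open import Relation.Binary using (_Preserves_⟶_; tri<; tri≈; tri>)
open import Relation.Nullary using (¬_; yes; no)


module _ {A : Set} where

  record Enumerates (P : A → Set) (L : List A) : Set where
    field
      unique   : Unique L
      complete : ∀ {a} → P a → a ∈ L
      sound    : ∀ {a} → a ∈ L → P a

  open Enumerates public

  enumerates⇒hasCount : ∀ {P L} → Enumerates P L → HasCount P (length L)
  enumerates⇒hasCount {L = L} e = L , unique e , (λ a → complete e , sound e) , refl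

  enumerates-cong : ∀ {P Q L} → (∀ {a} → P a → Q a) → (∀ {a} → Q a → P a) →
                    Enumerates P L → Enumerates Q L
  enumerates-cong P⇒Q Q⇒P e = record
    { unique = unique e ; complete = complete e ∘ Q⇒P ; sound = P⇒Q ∘ sound e }

  enumerates-++ : ∀ {P Q L M} → Enumerates P L → Enumerates Q M → (∀ {a} → P a → Q a → ⊥) →
                  Enumerates (λ a → P a ⊎ Q a) (L ++ M)
  enumerates-++ {L = L} eP eQ disjoint = record
    { unique   = Unique.++⁺ (unique eP) (unique eQ)
                   (λ (a∈L , a∈M) → disjoint (sound eP a∈L) (sound eQ a∈M))
    ; complete = λ { (inj₁ p) → ∈.∈-++⁺ˡ (complete eP p) ; (inj₂ q) → ∈.∈-++⁺ʳ L (complete eQ q) }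
    ; sound    = λ a∈ → Sum.map (sound eP) (sound eQ) (∈.∈-++⁻ L a∈)
    }

module _ {A B : Set} where

  Image : (A → B) → (A → Set) → B → Set
  Image f P b = ∃[ a ] P a × f a ≡ b

  InjectiveOn : (A → Set) → (A → B) → Set
  InjectiveOn P f = ∀ {a a′} → P a → P a′ → f a ≡ f a′ → a ≡ a′

  unique-map : ∀ {P f L} → InjectiveOn P f → All P L → Unique L → Unique (map f L)
  unique-map inj [] [] = []
  unique-map inj (pa ∷ pL) (a∉L ∷ u) =
    All.map⁺ (All.zipWith (λ (pa′ , a≢a′) fa≡fa′ → a≢a′ (inj pa pa′ fa≡fa′)) (pL , a∉L))
    ∷ unique-map inj pL u

  enumerates-map : ∀ {P f L} → InjectiveOn P f → Enumerates P L → Enumerates (Image f P) (map f L)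
  enumerates-map {f = f} inj e = record
    { unique   = unique-map inj (All.tabulate (sound e)) (unique e)
    ; complete = λ { (a , pa , refl) → ∈.∈-map⁺ f (complete e pa) }
    ; sound    = λ b∈ → let (a , a∈ , b≡fa) = ∈.∈-map⁻ f b∈ in a , sound e a∈ , sym b≡fa
    }

  image⊆ : ∀ {P : A → Set} {Q : B → Set} {f} → (∀ {a} → P a → Q (f a)) → ∀ {b} → Image f P b → Q b
  image⊆ f-sound (a , pa , refl) = f-sound pa

  images-disjoint : ∀ {P Q : A → Set} {f g : A → B} → (∀ {a a′} → P a → Q a′ → f a ≢ g a′) →
                    ∀ {b} → Image f P b → Image g Q b → ⊥
  images-disjoint f≢g (a , pa , refl) (a′ , qa′ , ga′≡fa) = f≢g pa qa′ (sym ga′≡fa)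


src tgt fix : EStep → ℕ
src (a , _ , _) = a
tgt (_ , b , _) = b
fix (_ , _ , z) = z

-- pt o a b has the coordinates a and b in the order chosen by o; a step (a → b ; z) goes from
-- pt o a z to pt o b z.
pt : Bool → ℕ → ℕ → Point
pt true  a b = (a , b)
pt false a b = (b , a)

pt-not : ∀ o a b → pt (not o) a b ≡ pt o b a
pt-not true  a b = refl
pt-not false a b = refl

pt-≡ : ∀ {o o′ a b c d} → pt o a b ≡ pt o′ c d →
       (o′ ≡ o × a ≡ c × b ≡ d) ⊎ (o′ ≡ not o × a ≡ d × b ≡ c)
pt-≡ {true}  {true}  refl = inj₁ (refl , refl , refl)
pt-≡ {true}  {false} refl = inj₂ (refl , refl , refl)
pt-≡ {false} {true}  refl = inj₂ (refl , refl , refl)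
pt-≡ {false} {false} refl = inj₁ (refl , refl , refl)

≡ᵇ-≢ : ∀ {m n} → m ≢ n → (m ≡ᵇ n) ≡ false
≡ᵇ-≢ {zero}  {zero}  m≢n = ⊥-elim (m≢n refl)
≡ᵇ-≢ {zero}  {suc n} m≢n = refl
≡ᵇ-≢ {suc m} {zero}  m≢n = refl
≡ᵇ-≢ {suc m} {suc n} m≢n = ≡ᵇ-≢ (m≢n ∘ cong suc)

≡ᵇ-refl : ∀ n → (n ≡ᵇ n) ≡ true
≡ᵇ-refl zero    = refl
≡ᵇ-refl (suc n) = ≡ᵇ-refl n

enh-pt : ∀ o {a b} z → a ≢ b → enh (pt o a z) (pt o b z) ≡ (a , b , z)
enh-pt true  z a≢b rewrite ≡ᵇ-≢ a≢b = refl
enh-pt false z a≢b rewrite ≡ᵇ-refl z = refl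

enh-pt′ : ∀ o z {a b} → a ≢ b → enh (pt o z a) (pt o z b) ≡ (a , b , z)
enh-pt′ true  z a≢b rewrite ≡ᵇ-refl z = refl
enh-pt′ false z a≢b rewrite ≡ᵇ-≢ a≢b = refl

tgt,fix⇒≡ : ∀ s {b z} → tgt s ≡ b → fix s ≡ z → s ≡ (src s , b , z)
tgt,fix⇒≡ s tgt≡ fix≡ = cong (src s ,_) (cong₂ _,_ tgt≡ fix≡)

validMove-pt : ∀ o {a b} z → a < b → ValidMove (pt o a z) (pt o b z)
validMove-pt true  z a<b = inj₂ (refl , a<b)
validMove-pt false z a<b = inj₁ (refl , a<b)

validMove-pt′ : ∀ o z {a b} → a < b → ValidMove (pt o z a) (pt o z b)
validMove-pt′ true  z a<b = inj₁ (refl , a<b)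
validMove-pt′ false z a<b = inj₂ (refl , a<b)

Move : Point → Point → EStep → Set
Move q p s = src s < tgt s × ∃[ o ] q ≡ pt o (src s) (fix s) × p ≡ pt o (tgt s) (fix s)

validMove⇒move : ∀ {q p} → ValidMove q p → Move q p (enh q p)
validMove⇒move {x , _} {.x , _} (inj₁ (refl , y<y′)) rewrite ≡ᵇ-refl x = y<y′ , false , refl , refl
validMove⇒move {x , y} {x′ , .y} (inj₂ (refl , x<x′)) rewrite ≡ᵇ-≢ (<⇒≢ x<x′) = x<x′ , true , refl , refl

_≤P_ : Point → Point → Set
(x , y) ≤P (x′ , y′) = x ≤ x′ × y ≤ y′

≤P-trans : ∀ {p q r} → p ≤P q → q ≤P r → p ≤P r
≤P-trans (x≤ , y≤) (x≤′ , y≤′) = ≤-trans x≤ x≤′ , ≤-trans y≤ y≤′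

validMove⇒≤P : ∀ {q p} → ValidMove q p → q ≤P p
validMove⇒≤P (inj₁ (refl , y<y′)) = ≤-refl , <⇒≤ y<y′
validMove⇒≤P (inj₂ (refl , x<x′)) = <⇒≤ x<x′ , ≤-refl

pt-≥ : ∀ o {a b} → (2 , 1) ≤P pt o a b → 1 ≤ a
pt-≥ true  (2≤a , _)  = ≤-trans (s≤s z≤n) 2≤a
pt-≥ false (_ , 1≤a) = 1≤a

pt-≤ : ∀ o {a b B} → pt o a b ≤P (B , B) → a ≤ B
pt-≤ true  (a≤ , _) = a≤
pt-≤ false (_ , a≤) = a≤

≤-pt : ∀ o {a b B} → a ≤ B → b ≤ B → pt o a b ≤P (B , B)
≤-pt true  a≤ b≤ = a≤ , b≤
≤-pt false a≤ b≤ = b≤ , a≤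

pt≡21⇒≤2 : ∀ o {a b} → pt o a b ≡ (2 , 1) → b ≤ 2
pt≡21⇒≤2 true  refl = s≤s z≤n
pt≡21⇒≤2 false refl = ≤-refl

OffDiagonal : Point → Set
OffDiagonal (x , y) = x ≢ y

offDiagonal-pt : ∀ o {a b} → a ≢ b → OffDiagonal (pt o a b)
offDiagonal-pt true  a≢b = a≢b
offDiagonal-pt false a≢b = a≢b ∘ sym

offDiagonal-pt⁻ : ∀ o {a b} → OffDiagonal (pt o a b) → a ≢ b
offDiagonal-pt⁻ true  a≢b = a≢b
offDiagonal-pt⁻ false b≢a = b≢a ∘ sym

Avoids : ℕ → Point → Set
Avoids v (x , y) = x ≢ v × y ≢ v

avoids-pt : ∀ o {v a b} → a ≢ v → b ≢ v → Avoids v (pt o a b)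
avoids-pt true  a≢v b≢v = a≢v , b≢v
avoids-pt false a≢v b≢v = b≢v , a≢v

avoids-pt⁻ : ∀ o {v a b} → Avoids v (pt o a b) → b ≢ v
avoids-pt⁻ true  (_ , b≢v) = b≢v
avoids-pt⁻ false (b≢v , _) = b≢v


-- Paths are listed backwards, from their last point down to (2 , 1), so walkSteps lists the
-- enhanced steps latest first.
Walk : List Point → Set
Walk []          = ⊥
Walk (p ∷ [])    = p ≡ (2 , 1)
Walk (p ∷ q ∷ r) = ValidMove q p × Walk (q ∷ r)

walkSteps : List Point → List EStep
walkSteps []          = []
walkSteps (p ∷ [])    = []
walkSteps (p ∷ q ∷ r) = enh q p ∷ walkSteps (q ∷ r)

walkSteps-pt : ∀ o {a b} z r → a < b →
               walkSteps (pt o b z ∷ pt o a z ∷ r) ≡ (a , b , z) ∷ walkSteps (pt o a z ∷ r)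
walkSteps-pt o z r a<b = cong (_∷ _) (enh-pt o z (<⇒≢ a<b))

walkSteps-pt′ : ∀ o z {a b} r → a < b →
                walkSteps (pt o z b ∷ pt o z a ∷ r) ≡ (a , b , z) ∷ walkSteps (pt o z a ∷ r)
walkSteps-pt′ o z r a<b = cong (_∷ _) (enh-pt′ o z (<⇒≢ a<b))

walk-≥ : ∀ {r} → Walk r → All ((2 , 1) ≤P_) r
walk-≥ {p ∷ []} refl = (≤-refl , ≤-refl) ∷ []
walk-≥ {p ∷ q ∷ r} (q→p , w) with walk-≥ w
... | q≥ ∷ r≥ = ≤P-trans q≥ (validMove⇒≤P q→p) ∷ q≥ ∷ r≥

walk-≤ : ∀ {p r} → Walk (p ∷ r) → All (_≤P p) (p ∷ r)
walk-≤ {p} {[]}    w         = (≤-refl , ≤-refl) ∷ []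
walk-≤ {p} {q ∷ r} (q→p , w) =
  (≤-refl , ≤-refl) ∷ All.map (λ r≤q → ≤P-trans r≤q (validMove⇒≤P q→p)) (walk-≤ w)

InRange : ℕ → EStep → Set
InRange B s = 1 ≤ src s × src s < tgt s × tgt s ≤ B

walk-inRange : ∀ {B p r} → Walk (p ∷ r) → p ≤P (B , B) → All (InRange B) (walkSteps (p ∷ r))
walk-inRange {r = []} w p≤ = []
walk-inRange {B} {p} {q ∷ r} (q→p , w) p≤ with enh q p | validMove⇒move q→p | walk-≥ w
... | s | src<tgt , o , q≡ , p≡ | q≥ ∷ _ =
  (pt-≥ o (subst ((2 , 1) ≤P_) q≡ q≥) , src<tgt , pt-≤ o (subst (_≤P (B , B)) p≡ p≤))
  ∷ walk-inRange w (≤P-trans (validMove⇒≤P q→p) p≤)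

walk-tgt≤ : ∀ o {a b B} r → Walk (pt o a b ∷ r) → a ≤ B → b ≤ B →
            All (λ s → tgt s ≤ B) (walkSteps (pt o a b ∷ r))
walk-tgt≤ o r w a≤ b≤ = All.map (proj₂ ∘ proj₂) (walk-inRange w (≤-pt o a≤ b≤))

walk-lastStep : ∀ {l q r b z} → Walk (l ∷ q ∷ r) → tgt (enh q l) ≡ b → fix (enh q l) ≡ z →
                ∃[ o ] l ≡ pt o b z × q ≡ pt o (src (enh q l)) z × src (enh q l) < b
walk-lastStep {l} {q} (q→l , _) tgt≡ fix≡ with enh q l | validMove⇒move q→l
... | s | s↑ , o , refl , refl rewrite tgt≡ | fix≡ = o , refl , refl , s↑

walk-avoids : ∀ {v r} → 3 ≤ v → Walk r → All (λ s → tgt s ≢ v) (walkSteps r) → All (Avoids v) r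
walk-avoids {r = p ∷ []} (s≤s (s≤s (s≤s _))) refl [] = ((λ ()) , (λ ())) ∷ []
walk-avoids {v} {p ∷ q ∷ r} 3≤v (q→p , w) (tgt≢v ∷ tgts≢v)
  with enh q p | validMove⇒move q→p | walk-avoids 3≤v w tgts≢v | tgt≢v
... | s | _ , o , refl , refl | q-avoids ∷ r-avoids | s-tgt≢v =
  avoids-pt o s-tgt≢v (avoids-pt⁻ o q-avoids) ∷ q-avoids ∷ r-avoids

-- Going back from a point with coordinates e and n, the steps run along the line on which one
-- coordinate is n (Runs) until the step that entered that line (Enters).
mutual
  LineEntry : ℕ → ℕ → List EStep → Set
  LineEntry n e ss = Enters n e ss ⊎ Runs n e ss

  Enters : ℕ → ℕ → List EStep → Set
  Enters n e []      = ⊥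
  Enters n e (s ∷ _) = tgt s ≡ n × fix s ≡ e

  Runs : ℕ → ℕ → List EStep → Set
  Runs n e []       = ⊥
  Runs n e (s ∷ ss) = tgt s ≡ e × fix s ≡ n × LineEntry n (src s) ss

walk-lineEntry : ∀ {n e o p r} → 3 ≤ n → Walk (p ∷ r) → p ≡ pt o e n →
                 LineEntry n e (walkSteps (p ∷ r))
walk-lineEntry {o = o} {r = []} 3≤n refl p≡ = ⊥-elim (≤⇒≯ (pt≡21⇒≤2 o (sym p≡)) 3≤n)
walk-lineEntry {p = p} {q ∷ r} 3≤n (q→p , w) p≡ with enh q p | validMove⇒move q→p
... | s | _ , o′ , q≡ , p≡′ with pt-≡ (trans (sym p≡′) p≡)
...   | inj₁ (_ , tgt≡e , fix≡n) =
  inj₂ (tgt≡e , fix≡n , walk-lineEntry 3≤n w (trans q≡ (cong (pt o′ (src s)) fix≡n)))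
...   | inj₂ (_ , tgt≡n , fix≡e) = inj₁ (tgt≡n , fix≡e)


-- The coherence condition for steps s ≺ t.  It involves t only through src t and fix t, so
-- retargeting the last step of a path does not affect it.
Compatible : EStep → EStep → Set
Compatible s t = src t < tgt s → tgt s ≡ fix t ⊎ src t ≡ fix s

compatible-vacuous : ∀ {s a b z} → tgt s ≤ a → Compatible s (a , b , z)
compatible-vacuous tgt≤a a<tgt = ⊥-elim (<⇒≱ a<tgt tgt≤a)

compatible-onto : ∀ {s a b} → tgt s ≤ suc a → Compatible s (a , b , suc a)
compatible-onto tgt≤ a<tgt = inj₁ (≤-antisym tgt≤ a<tgt)

compatible-refix : ∀ {s a b c b′ c′} → tgt s ≢ c → Compatible s (a , b , c) → Compatible s (a , b′ , c′)
compatible-refix tgt≢c compat a<tgt with compat a<tgt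
... | inj₁ tgt≡c = ⊥-elim (tgt≢c tgt≡c)
... | inj₂ a≡fix = inj₂ a≡fix

compatibles-refix : ∀ {a b k b′ c′ ss} → All (λ s → tgt s ≤ k) ss →
                    All (λ s → Compatible s (a , b , suc k)) ss → All (λ s → Compatible s (a , b′ , c′)) ss
compatibles-refix {b = b} {b′ = b′} {c′ = c′} tgt≤k compat =
  All.zipWith
    (λ {s} (tgt≤ , c) → compatible-refix {s} {b = b} {b′ = b′} {c′ = c′} (λ { refl → 1+n≰n tgt≤ }) c)
    (tgt≤k , compat)

compatible-run : ∀ {s t t′} → Compatible s t → Compatible s t′ → fix t ≡ fix t′ →
                 src t′ < src t → src t < tgt s → tgt s ≡ fix t
compatible-run c c′ fix≡ t′<t t<s with c t<s
... | inj₁ tgt≡ = tgt≡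
... | inj₂ src≡ with c′ (<-trans t′<t t<s)
...   | inj₁ tgt≡′ = trans tgt≡′ (sym fix≡)
...   | inj₂ src≡′ = ⊥-elim (<⇒≢ t′<t (trans src≡′ (sym src≡)))

CoherentWalk : List Point → Set
CoherentWalk r = Walk r × All OffDiagonal r × AllPairs (flip Compatible) (walkSteps r)

coherentWalk-tail : ∀ {p q r} → CoherentWalk (p ∷ q ∷ r) → CoherentWalk (q ∷ r)
coherentWalk-tail ((_ , w) , _ ∷ nd , _ ∷ coh) = w , nd , coh

coherentWalk-extend : ∀ o {a b} z r → CoherentWalk (pt o a z ∷ r) → a < b → b ≢ z →
                      All (λ s → Compatible s (a , b , z)) (walkSteps (pt o a z ∷ r)) →
                      CoherentWalk (pt o b z ∷ pt o a z ∷ r)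
coherentWalk-extend o z r (w , nd , coh) a<b b≢z compat =
  (validMove-pt o z a<b , w) , offDiagonal-pt o b≢z ∷ nd ,
  subst (AllPairs (flip Compatible)) (sym (walkSteps-pt o z r a<b)) (compat ∷ coh)

coherentWalk-extend′ : ∀ o z {a b} r → CoherentWalk (pt o z a ∷ r) → a < b → z ≢ b →
                       All (λ s → Compatible s (a , b , z)) (walkSteps (pt o z a ∷ r)) →
                       CoherentWalk (pt o z b ∷ pt o z a ∷ r)
coherentWalk-extend′ o z r (w , nd , coh) a<b z≢b compat =
  (validMove-pt′ o z a<b , w) , offDiagonal-pt o z≢b ∷ nd ,
  subst (AllPairs (flip Compatible)) (sym (walkSteps-pt′ o z r a<b)) (compat ∷ coh)

coherentWalk-last : ∀ o {a b} z r → CoherentWalk (pt o b z ∷ pt o a z ∷ r) → a < b →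
                    All (λ s → Compatible s (a , b , z)) (walkSteps (pt o a z ∷ r))
coherentWalk-last o z r (_ , _ , compat ∷ _) a<b =
  subst (λ t → All (λ s → Compatible s t) _) (enh-pt o z (<⇒≢ a<b)) compat

coherentWalk-last′ : ∀ o z {a b} r → CoherentWalk (pt o z b ∷ pt o z a ∷ r) → a < b →
                     All (λ s → Compatible s (a , b , z)) (walkSteps (pt o z a ∷ r))
coherentWalk-last′ o z r (_ , _ , compat ∷ _) a<b =
  subst (λ t → All (λ s → Compatible s t) _) (enh-pt′ o z (<⇒≢ a<b)) compat

coherentWalk-avoids : ∀ o {a y′ y z v} r → CoherentWalk (pt o a z ∷ pt o y z ∷ pt o y′ z ∷ r) →
                      y′ < y → y < a → y < v → v ≢ z → 3 ≤ v → All (Avoids v) (pt o y′ z ∷ r)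
coherentWalk-avoids o {a} {y′} {y} {z} {v} r cw y′<y y<a y<v v≢z 3≤v =
  walk-avoids {r = pt o y′ z ∷ r} 3≤v (proj₁ (coherentWalk-tail (coherentWalk-tail cw)))
    (All.zipWith (λ {s} → avoid {s}) (last , secondLast))
  where
  last : All (λ s → Compatible s (y , a , z)) (walkSteps (pt o y′ z ∷ r))
  last = All.tail (subst (All (λ s → Compatible s (y , a , z))) (walkSteps-pt o z r y′<y)
                    (coherentWalk-last o z (pt o y′ z ∷ r) cw y<a))
  secondLast : All (λ s → Compatible s (y′ , y , z)) (walkSteps (pt o y′ z ∷ r))
  secondLast = coherentWalk-last o z r (coherentWalk-tail cw) y′<y
  avoid : ∀ {s} → Compatible s (y , a , z) × Compatible s (y′ , y , z) → tgt s ≢ v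
  avoid {s} (c , c′) refl = v≢z (compatible-run {s} {y , a , z} {y′ , y , z} c c′ refl y′<y y<v)

lineEntry-incompatible : ∀ {B n e t ss} → LineEntry n e ss → All (InRange B) ss →
                         All (λ s → Compatible s t) ss → src t < n → n ≢ fix t → e < src t → ⊥
lineEntry-incompatible {ss = s ∷ _} (inj₁ (refl , refl)) _ (c ∷ _) t<n n≢fix e<t with c t<n
... | inj₁ n≡fix = n≢fix n≡fix
... | inj₂ t≡e   = <⇒≢ e<t (sym t≡e)
lineEntry-incompatible {B} {n} {t = t} {s ∷ ss} (inj₂ (refl , _ , entry)) ((_ , s↑ , _) ∷ inRange) (_ ∷ cs)
                       t<n n≢fix e<t =
  lineEntry-incompatible {B} {n} {src s} {t} {ss} entry inRange cs t<n n≢fix (<-trans s↑ e<t)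

runs-incompatible : ∀ {B n e t} ss → Runs n e ss → All (InRange B) ss → All (λ s → Compatible s t) ss →
                    src t ≡ e → e < n → n ≢ fix t → ⊥
runs-incompatible {B} {n} {t = t} (s ∷ ss) (tgt≡e , _ , entry) ((_ , s↑ , _) ∷ inRange) (_ ∷ compat)
                  refl e<n n≢fix =
  lineEntry-incompatible {B} {n} {src s} {t} {ss} entry inRange compat e<n n≢fix (subst (src s <_) tgt≡e s↑)


EndsAt : ℕ → List Point → Set
EndsAt m []      = ⊥
EndsAt m (l ∷ _) = ∃[ o ] l ≡ pt o m (suc m)

-- A coherent lattice path of size suc m, listed backwards.
Path : ℕ → List Point → Set
Path m r = CoherentWalk r × EndsAt m r

path-inRange : ∀ {m r} → Path m r → All (InRange (suc m)) (walkSteps r)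
path-inRange {m} {l ∷ r} ((w , _) , o , refl) = walk-inRange w (≤-pt o (n≤1+n m) ≤-refl)

turned-end : ∀ o m → ∃[ o′ ] pt o (suc (suc m)) (suc m) ≡ pt o′ (suc m) (suc (suc m))
turned-end o m = not o , sym (pt-not o (suc m) (suc (suc m)))

-- The types t, q and c of paths of size suc m; EndsQC m says that the path arrives at its
-- endpoint along the line of coordinate suc m.
EndsT EndsQC EndsQ EndsC : ℕ → List EStep → Set
EndsT m []      = ⊥
EndsT m (s ∷ _) = tgt s ≡ suc m × fix s ≡ m
EndsQC m = Runs (suc m) m
EndsQ m []       = ⊥
EndsQ m (s ∷ ss) = tgt s ≡ m × fix s ≡ suc m × Runs (suc m) (src s) ss
EndsC m []       = ⊥
EndsC m (s ∷ ss) = tgt s ≡ m × fix s ≡ suc m × Enters (suc m) (src s) ss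

TPath QPath CPath QCPath : ℕ → List Point → Set
TPath m r  = Path m r × EndsT m (walkSteps r)
QPath m r  = Path m r × EndsQ m (walkSteps r)
CPath m r  = Path m r × EndsC m (walkSteps r)
QCPath m r = Path m r × EndsQC m (walkSteps r)

endsQ⇒endsQC : ∀ {m} ss → EndsQ m ss → EndsQC m ss
endsQ⇒endsQC (s ∷ ss) (tgt≡ , fix≡ , runs) = tgt≡ , fix≡ , inj₂ runs

endsC⇒endsQC : ∀ {m} ss → EndsC m ss → EndsQC m ss
endsC⇒endsQC (s ∷ ss) (tgt≡ , fix≡ , enters) = tgt≡ , fix≡ , inj₁ enters

endsQC-split : ∀ {m} ss → EndsQC m ss → EndsQ m ss ⊎ EndsC m ss
endsQC-split (s ∷ ss) (tgt≡ , fix≡ , inj₁ enters) = inj₂ (tgt≡ , fix≡ , enters)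
endsQC-split (s ∷ ss) (tgt≡ , fix≡ , inj₂ runs)   = inj₁ (tgt≡ , fix≡ , runs)

endsT-endsQC-disjoint : ∀ {m} ss → EndsT m ss → EndsQC m ss → ⊥
endsT-endsQC-disjoint (s ∷ _) (tgt≡ , _) (tgt≡′ , _) = 1+n≢n (trans (sym tgt≡) tgt≡′)

endsQ-endsC-disjoint : ∀ {m B} ss → All (InRange B) ss → EndsQ m ss → EndsC m ss → ⊥
endsQ-endsC-disjoint {m} (s ∷ s′ ∷ _) ((_ , s↑ , _) ∷ _) (tgt≡m , _ , tgt′≡src , _)
                     (_ , _ , tgt′≡M , _) =
  <-asym (n<1+n m) (subst₂ _<_ (trans (sym tgt′≡src) tgt′≡M) tgt≡m s↑)

path-classify : ∀ {m r} → 2 ≤ m → Path m r → EndsT m (walkSteps r) ⊎ EndsQC m (walkSteps r)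
path-classify {m} {l ∷ []} 2≤m ((refl , _) , o , l≡) = ⊥-elim (≤⇒≯ (pt≡21⇒≤2 o (sym l≡)) (s≤s 2≤m))
path-classify {m} {l ∷ q ∷ r} 2≤m (((q→l , w) , _) , o , l≡) with enh q l | validMove⇒move q→l
... | s | _ , o′ , q≡ , l≡′ with pt-≡ (trans (sym l≡′) l≡)
...   | inj₂ (_ , tgt≡ , fix≡) = inj₁ (tgt≡ , fix≡)
...   | inj₁ (_ , tgt≡ , fix≡) =
  inj₂ (tgt≡ , fix≡ , walk-lineEntry (s≤s 2≤m) w (trans q≡ (cong (pt o′ (src s)) fix≡)))

tPath-view : ∀ {m r} → TPath m r →
             ∃[ o ] ∃[ x ] ∃[ r′ ] r ≡ pt o (suc m) m ∷ pt o x m ∷ r′ × x < suc m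
tPath-view {r = l ∷ q ∷ r′} (((w , _) , _) , tgt≡ , fix≡) with walk-lastStep w tgt≡ fix≡
... | o , l≡ , q≡ , x<M = o , _ , r′ , cong₂ (λ p p′ → p ∷ p′ ∷ r′) l≡ q≡ , x<M

qcPath-view : ∀ {m r} → QCPath m r →
              ∃[ o ] ∃[ y ] ∃[ r′ ] r ≡ pt o m (suc m) ∷ pt o y (suc m) ∷ r′ × y < m
qcPath-view {r = l ∷ q ∷ r′} (((w , _) , _) , tgt≡ , fix≡ , _) with walk-lastStep w tgt≡ fix≡
... | o , l≡ , q≡ , y<m = o , _ , r′ , cong₂ (λ p p′ → p ∷ p′ ∷ r′) l≡ q≡ , y<m

cPath-view : ∀ {m r} → CPath m r →
             ∃[ o ] ∃[ x ] ∃[ y ] ∃[ r′ ]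
               r ≡ pt o m (suc m) ∷ pt o y (suc m) ∷ pt o y x ∷ r′ × y < m × x < suc m
cPath-view {m} {l ∷ q ∷ q′ ∷ r′} (((w , _) , _) , tgt≡ , fix≡ , tgt′≡ , fix′≡)
  with walk-lastStep w tgt≡ fix≡ | walk-lastStep (proj₂ w) tgt′≡ fix′≡
... | o , l≡ , q≡ , y<m | o′ , q≡′ , q′≡ , x<M with pt-≡ (trans (sym q≡) q≡′)
...   | inj₁ (_ , y≡M , _) = ⊥-elim (<-asym y<m (subst (m <_) (sym y≡M) (n<1+n m)))
...   | inj₂ (refl , _ , _) =
  o , _ , _ , r′ ,
  cong₂ (λ p p′ → p ∷ p′) l≡ (cong₂ (λ p p′ → p ∷ p′ ∷ r′) q≡ (trans q′≡ (pt-not o _ _))) , y<m , x<M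

qPath-view : ∀ {m r} → QPath m r →
             ∃[ o ] ∃[ y′ ] ∃[ y ] ∃[ r′ ]
               r ≡ pt o m (suc m) ∷ pt o y (suc m) ∷ pt o y′ (suc m) ∷ r′ × 1 ≤ y′ × y′ < y × y < m
qPath-view {m} {l ∷ q ∷ q′ ∷ r′} (((w , _) , _) , tgt≡ , fix≡ , tgt′≡ , fix′≡ , _)
  with walk-lastStep w tgt≡ fix≡ | walk-lastStep (proj₂ w) tgt′≡ fix′≡ | walk-≥ (proj₂ (proj₂ w))
... | o , l≡ , q≡ , y<m | o′ , q≡′ , q′≡ , y′<y | q′≥ ∷ _ with pt-≡ (trans (sym q≡) q≡′)
...   | inj₂ (_ , y≡M , _) = ⊥-elim (<-asym y<m (subst (m <_) (sym y≡M) (n<1+n m)))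
...   | inj₁ (refl , _ , _) =
  o , _ , _ , r′ , cong₂ (λ p p′ → p ∷ p′) l≡ (cong₂ (λ p p′ → p ∷ p′ ∷ r′) q≡ q′≡) ,
  pt-≥ o (subst ((2 , 1) ≤P_) q′≡ q′≥) , y′<y , y<m

qPath-3≤ : ∀ {m r} → QPath m r → 3 ≤ m
qPath-3≤ q with qPath-view q
... | _ , _ , _ , _ , _ , 1≤y′ , y′<y , y<m = ≤-trans (s≤s (≤-trans (s≤s 1≤y′) y′<y)) y<m


-- Relabelling coordinates

mapPoint : (ℕ → ℕ) → Point → Point
mapPoint f (x , y) = (f x , f y)

mapStep : (ℕ → ℕ) → EStep → EStep
mapStep f (a , b , z) = (f a , f b , f z)

mapPoint-pt : ∀ f o a b → mapPoint f (pt o a b) ≡ pt o (f a) (f b)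
mapPoint-pt f true  a b = refl
mapPoint-pt f false a b = refl

mapPoint-pt′ : ∀ f o {a b a′ b′} → f a ≡ a′ → f b ≡ b′ → mapPoint f (pt o a b) ≡ pt o a′ b′
mapPoint-pt′ f o fa≡ fb≡ = trans (mapPoint-pt f o _ _) (cong₂ (pt o) fa≡ fb≡)

module Relabel {f : ℕ → ℕ} (f-mono : f Preserves _<_ ⟶ _<_) where

  f-injective : ∀ {a b} → f a ≡ f b → a ≡ b
  f-injective {a} {b} fa≡fb with <-cmp a b
  ... | tri< a<b _ _ = ⊥-elim (<⇒≢ (f-mono a<b) fa≡fb)
  ... | tri≈ _ a≡b _ = a≡b
  ... | tri> _ _ b<a = ⊥-elim (<⇒≢ (f-mono b<a) (sym fa≡fb))

  f-reflects-< : ∀ {a b} → f a < f b → a < b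
  f-reflects-< {a} {b} fa<fb with <-cmp a b
  ... | tri< a<b _ _  = a<b
  ... | tri≈ _ refl _ = ⊥-elim (<-irrefl refl fa<fb)
  ... | tri> _ _ b<a  = ⊥-elim (<-asym fa<fb (f-mono b<a))

  ≡ᵇ-map : ∀ a b → (f a ≡ᵇ f b) ≡ (a ≡ᵇ b)
  ≡ᵇ-map a b with a ≟ b
  ... | yes refl = trans (≡ᵇ-refl (f a)) (sym (≡ᵇ-refl a))
  ... | no a≢b   = trans (≡ᵇ-≢ (a≢b ∘ f-injective)) (sym (≡ᵇ-≢ a≢b))

  enh-map : ∀ q p → enh (mapPoint f q) (mapPoint f p) ≡ mapStep f (enh q p)
  enh-map (x , y) (x′ , y′) rewrite ≡ᵇ-map x x′ with x ≡ᵇ x′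
  ... | true  = refl
  ... | false = refl

  walkSteps-map : ∀ r → walkSteps (map (mapPoint f) r) ≡ map (mapStep f) (walkSteps r)
  walkSteps-map []          = refl
  walkSteps-map (p ∷ [])    = refl
  walkSteps-map (p ∷ q ∷ r) = cong₂ _∷_ (enh-map q p) (walkSteps-map (q ∷ r))

  mapPoint-injective : ∀ {p q} → mapPoint f p ≡ mapPoint f q → p ≡ q
  mapPoint-injective e = cong₂ _,_ (f-injective (cong proj₁ e)) (f-injective (cong proj₂ e))

  mapPoint-pt⁻ : ∀ {p} o a b → mapPoint f p ≡ pt o (f a) (f b) → p ≡ pt o a b
  mapPoint-pt⁻ o a b e = mapPoint-injective (trans e (sym (mapPoint-pt f o a b)))

  validMove-map⁺ : ∀ {q p} → ValidMove q p → ValidMove (mapPoint f q) (mapPoint f p)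
  validMove-map⁺ (inj₁ (refl , y<y′)) = inj₁ (refl , f-mono y<y′)
  validMove-map⁺ (inj₂ (refl , x<x′)) = inj₂ (refl , f-mono x<x′)

  validMove-map⁻ : ∀ {q p} → ValidMove (mapPoint f q) (mapPoint f p) → ValidMove q p
  validMove-map⁻ (inj₁ (fx≡ , fy<)) = inj₁ (f-injective fx≡ , f-reflects-< fy<)
  validMove-map⁻ (inj₂ (fy≡ , fx<)) = inj₂ (f-injective fy≡ , f-reflects-< fx<)

  compatible-map⁺ : ∀ {s t} → Compatible s t → Compatible (mapStep f s) (mapStep f t)
  compatible-map⁺ c ft<fs = Sum.map (cong f) (cong f) (c (f-reflects-< ft<fs))

  compatible-map⁻ : ∀ {s t} → Compatible (mapStep f s) (mapStep f t) → Compatible s t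
  compatible-map⁻ c t<s = Sum.map f-injective f-injective (c (f-mono t<s))

  coherent-map⁺ : ∀ {ss} → AllPairs (flip Compatible) ss →
                  AllPairs (flip Compatible) (map (mapStep f) ss)
  coherent-map⁺ coh = AllPairs.map⁺ (AllPairs.map (λ {s} {t} → compatible-map⁺ {t} {s}) coh)

  coherent-map⁻ : ∀ {ss} → AllPairs (flip Compatible) (map (mapStep f) ss) →
                  AllPairs (flip Compatible) ss
  coherent-map⁻ coh = AllPairs.map (λ {s} {t} → compatible-map⁻ {t} {s}) (AllPairs.map⁻ coh)

  offDiagonal-map⁺ : ∀ {p} → OffDiagonal p → OffDiagonal (mapPoint f p)
  offDiagonal-map⁺ x≢y = x≢y ∘ f-injective

  offDiagonal-map⁻ : ∀ {p} → OffDiagonal (mapPoint f p) → OffDiagonal p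
  offDiagonal-map⁻ fx≢fy = fx≢fy ∘ cong f

  lineEntry-map⁺ : ∀ {n e} ss → LineEntry n e ss → LineEntry (f n) (f e) (map (mapStep f) ss)
  runs-map⁺ : ∀ {n e} ss → Runs n e ss → Runs (f n) (f e) (map (mapStep f) ss)
  lineEntry-map⁺ (s ∷ ss) (inj₁ (tgt≡ , fix≡)) = inj₁ (cong f tgt≡ , cong f fix≡)
  lineEntry-map⁺ ss       (inj₂ runs)          = inj₂ (runs-map⁺ ss runs)
  runs-map⁺ (s ∷ ss) (tgt≡ , fix≡ , entry) = cong f tgt≡ , cong f fix≡ , lineEntry-map⁺ ss entry

  lineEntry-map⁻ : ∀ {n e} ss → LineEntry (f n) (f e) (map (mapStep f) ss) → LineEntry n e ss
  runs-map⁻ : ∀ {n e} ss → Runs (f n) (f e) (map (mapStep f) ss) → Runs n e ss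
  lineEntry-map⁻ (s ∷ ss) (inj₁ (tgt≡ , fix≡)) = inj₁ (f-injective tgt≡ , f-injective fix≡)
  lineEntry-map⁻ ss       (inj₂ runs)          = inj₂ (runs-map⁻ ss runs)
  runs-map⁻ (s ∷ ss) (tgt≡ , fix≡ , entry) =
    f-injective tgt≡ , f-injective fix≡ , lineEntry-map⁻ ss entry

  module _ {m m′ : ℕ} (fm : f m ≡ m′) (fM : f (suc m) ≡ suc m′) where

    endsAt-map⁺ : ∀ {r} → EndsAt m r → EndsAt m′ (map (mapPoint f) r)
    endsAt-map⁺ {l ∷ r} (o , refl) = o , trans (mapPoint-pt f o m (suc m)) (cong₂ (pt o) fm fM)

    endsAt-map⁻ : ∀ {r} → EndsAt m′ (map (mapPoint f) r) → EndsAt m r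
    endsAt-map⁻ {l ∷ r} (o , l≡) = o , mapPoint-pt⁻ o m (suc m) (trans l≡ (sym (cong₂ (pt o) fm fM)))

    endsQ-map⁺ : ∀ ss → EndsQ m ss → EndsQ m′ (map (mapStep f) ss)
    endsQ-map⁺ (s ∷ ss) (tgt≡ , fix≡ , runs) =
      trans (cong f tgt≡) fm , trans (cong f fix≡) fM ,
      subst (λ n → Runs n (f (src s)) (map (mapStep f) ss)) fM (runs-map⁺ ss runs)

    endsQ-map⁻ : ∀ ss → EndsQ m′ (map (mapStep f) ss) → EndsQ m ss
    endsQ-map⁻ (s ∷ ss) (tgt≡ , fix≡ , runs) =
      f-injective (trans tgt≡ (sym fm)) , f-injective (trans fix≡ (sym fM)) ,
      runs-map⁻ ss (subst (λ n → Runs n (f (src s)) (map (mapStep f) ss)) (sym fM) runs)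

  module _ (f1 : f 1 ≡ 1) (f2 : f 2 ≡ 2) where

    walk-map⁺ : ∀ {r} → Walk r → Walk (map (mapPoint f) r)
    walk-map⁺ {p ∷ []}    refl      = cong₂ _,_ f2 f1
    walk-map⁺ {p ∷ q ∷ r} (q→p , w) = validMove-map⁺ q→p , walk-map⁺ w

    walk-map⁻ : ∀ {r} → Walk (map (mapPoint f) r) → Walk r
    walk-map⁻ {p ∷ []}    fp≡ = mapPoint-injective (trans fp≡ (sym (cong₂ _,_ f2 f1)))
    walk-map⁻ {p ∷ q ∷ r} (q→p , w) = validMove-map⁻ q→p , walk-map⁻ w

    coherentWalk-map⁺ : ∀ {r} → CoherentWalk r → CoherentWalk (map (mapPoint f) r)
    coherentWalk-map⁺ {r} (w , nd , coh) =
      walk-map⁺ w , All.map⁺ (All.map offDiagonal-map⁺ nd) ,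
      subst (AllPairs (flip Compatible)) (sym (walkSteps-map r)) (coherent-map⁺ coh)

    coherentWalk-map⁻ : ∀ {r} → CoherentWalk (map (mapPoint f) r) → CoherentWalk r
    coherentWalk-map⁻ {r} (w , nd , coh) =
      walk-map⁻ w , All.map offDiagonal-map⁻ (All.map⁻ nd) ,
      coherent-map⁻ (subst (AllPairs (flip Compatible)) (walkSteps-map r) coh)

-- skip k is the increasing bijection from ℕ onto ℕ ∖ {k}: relabelling a path by it frees the
-- value k.
skip : ℕ → ℕ → ℕ
skip zero    v       = suc v
skip (suc k) zero    = zero
skip (suc k) (suc v) = suc (skip k v)

unskip : ℕ → ℕ → ℕ
unskip zero    v       = pred v
unskip (suc k) zero    = zero
unskip (suc k) (suc v) = suc (unskip k v)

skip-< : ∀ {k v} → v < k → skip k v ≡ v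
skip-< {suc k} {zero}  _         = refl
skip-< {suc k} {suc v} (s≤s v<k) = cong suc (skip-< v<k)

skip-≥ : ∀ {k v} → k ≤ v → skip k v ≡ suc v
skip-≥ {zero}  _         = refl
skip-≥ {suc k} {suc v} (s≤s k≤v) = cong suc (skip-≥ k≤v)

skip-mono : ∀ k → skip k Preserves _<_ ⟶ _<_
skip-mono zero    u<v                     = s≤s u<v
skip-mono (suc k) {zero}  {suc v} _       = s≤s z≤n
skip-mono (suc k) {suc u} {suc v} (s≤s u<v) = s≤s (skip-mono k u<v)

skip-unskip : ∀ k {v} → v ≢ k → skip k (unskip k v) ≡ v
skip-unskip zero    {zero}  v≢k = ⊥-elim (v≢k refl)
skip-unskip zero    {suc v} v≢k = refl
skip-unskip (suc k) {zero}  v≢k = refl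
skip-unskip (suc k) {suc v} v≢k = cong suc (skip-unskip k (v≢k ∘ cong suc))

skip-unskip-points : ∀ k {r} → All (Avoids k) r →
                     map (mapPoint (skip k)) (map (mapPoint (unskip k)) r) ≡ r
skip-unskip-points k []                  = refl
skip-unskip-points k ((x≢k , y≢k) ∷ av) =
  cong₂ _∷_ (cong₂ _,_ (skip-unskip k x≢k) (skip-unskip k y≢k)) (skip-unskip-points k av)

coherentWalk-skip⁺ : ∀ {k r} → 3 ≤ k → CoherentWalk r → CoherentWalk (map (mapPoint (skip k)) r)
coherentWalk-skip⁺ {k} 3≤k =
  Relabel.coherentWalk-map⁺ (skip-mono k) (skip-< (≤-trans (s≤s (s≤s z≤n)) 3≤k)) (skip-< 3≤k)

coherentWalk-skip⁻ : ∀ {k r} → 3 ≤ k → CoherentWalk (map (mapPoint (skip k)) r) → CoherentWalk r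
coherentWalk-skip⁻ {k} 3≤k =
  Relabel.coherentWalk-map⁻ (skip-mono k) (skip-< (≤-trans (s≤s (s≤s z≤n)) 3≤k)) (skip-< 3≤k)

skip-end : ∀ o m → mapPoint (skip m) (pt o m (suc m)) ≡ pt o (suc m) (suc (suc m))
skip-end o m = mapPoint-pt′ (skip m) o (skip-≥ ≤-refl) (skip-≥ (n≤1+n m))

skip-end′ : ∀ o m → mapPoint (skip m) (pt o (suc m) m) ≡ pt o (suc (suc m)) (suc m)
skip-end′ o m = mapPoint-pt′ (skip m) o (skip-≥ (n≤1+n m)) (skip-≥ ≤-refl)

skip-line : ∀ o {a m} → a < suc m → mapPoint (skip (suc m)) (pt o a (suc m)) ≡ pt o a (suc (suc m))
skip-line o a<M = mapPoint-pt′ (skip _) o (skip-< a<M) (skip-≥ ≤-refl)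

skip-line′ : ∀ o {a m} → a < suc m → mapPoint (skip (suc m)) (pt o (suc m) a) ≡ pt o (suc (suc m)) a
skip-line′ o a<M = mapPoint-pt′ (skip _) o (skip-≥ ≤-refl) (skip-< a<M)

compatible-skip : ∀ {s m b} → tgt s ≤ suc m →
                  Compatible (mapStep (skip (suc m)) s) (m , b , suc (suc m))
compatible-skip {s} {m} tgt≤M m<τtgt with tgt s ≟ suc m
... | yes tgt≡M = inj₁ (trans (cong (skip (suc m)) tgt≡M) (skip-≥ ≤-refl))
... | no  tgt≢M = ⊥-elim (<⇒≱ m<τtgt (subst (_≤ m) (sym (skip-< tgt<M)) (≤-pred tgt<M)))
  where tgt<M = ≤∧≢⇒< tgt≤M tgt≢M

runs-skip : ∀ {m} ss → EndsQC m ss → Runs (suc (suc m)) m (map (mapStep (skip (suc m))) ss)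
runs-skip {m} ss runs =
  subst₂ (λ n e → Runs n e (map (mapStep (skip (suc m))) ss)) (skip-≥ ≤-refl) (skip-< (n<1+n m))
    (runs-map⁺ ss runs)
  where open Relabel (skip-mono (suc m))


-- From size n to size n + 1

n<ᵇ1+n : ∀ n → (n <ᵇ suc n) ≡ true
n<ᵇ1+n zero    = refl
n<ᵇ1+n (suc n) = n<ᵇ1+n n

1+n≮ᵇn : ∀ n → (suc n <ᵇ n) ≡ false
1+n≮ᵇn zero    = refl
1+n≮ᵇn (suc n) = 1+n≮ᵇn n

raise : Point → Point
raise (a , b) = if a <ᵇ b then (suc b , b) else (a , suc a)

raise-end : ∀ o m → raise (pt o m (suc m)) ≡ pt o (suc (suc m)) (suc m)
raise-end true  m rewrite n<ᵇ1+n m = refl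
raise-end false m rewrite 1+n≮ᵇn m = refl

-- For paths of size n = suc m, these account for the matrix entries:
-- t′ = toT₁ (t + q + c) + toT₂ (q + c), q′ = toQ₁ (q + c) + toQ₂ q and
-- c′ = toC₁ t + toC₂ t + toC₃ c + toC₄ c.
toT₁ toT₂ : List Point → List Point
toT₁ []      = []
toT₁ (l ∷ r) = raise l ∷ l ∷ r
toT₂ []      = []
toT₂ (l ∷ r) = raise l ∷ r

toQ₁ toQ₂ toC₁ toC₂ toC₃ toC₄ : ℕ → List Point → List Point
toQ₁ m []      = []
toQ₁ m (l ∷ r) = mapPoint (skip m) l ∷ map (mapPoint (skip (suc m))) (l ∷ r)
toQ₂ m r       = map (mapPoint (skip m)) r
toC₁ m []      = []
toC₁ m (l ∷ r) = mapPoint (skip m) l ∷ mapPoint (skip (suc m)) l ∷ l ∷ r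
toC₂ m []      = []
toC₂ m (l ∷ r) = mapPoint (skip m) l ∷ mapPoint (skip (suc m)) l ∷ r
toC₃ m (l ∷ p ∷ r) = mapPoint (skip m) l ∷ mapPoint (skip (suc m)) p ∷ p ∷ r
toC₃ m r           = r
toC₄ m (l ∷ p ∷ r) = mapPoint (skip m) l ∷ mapPoint (skip (suc m)) p ∷ r
toC₄ m r           = r

toT₁-sound : ∀ {m r} → Path m r → TPath (suc m) (toT₁ r)
toT₁-sound {m} {l ∷ r} (cw@(w , _) , o , refl) rewrite raise-end o m =
  (coherentWalk-extend o (suc m) r cw m<M′ 1+n≢n compat , turned-end o m) ,
  subst (EndsT (suc m)) (sym (walkSteps-pt o (suc m) r m<M′)) (refl , refl)
  where
  m<M′ = m<n⇒m<1+n (n<1+n m)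
  compat : All (λ s → Compatible s (m , suc (suc m) , suc m)) (walkSteps (pt o m (suc m) ∷ r))
  compat = All.map (λ {s} → compatible-onto {s} {b = suc (suc m)}) (walk-tgt≤ o r w (n≤1+n m) ≤-refl)

toT₂-sound : ∀ {m r} → QCPath m r → TPath (suc m) (toT₂ r)
toT₂-sound {m} qc with qcPath-view qc
... | o , y , r′ , refl , y<m rewrite raise-end o m =
  (coherentWalk-extend o (suc m) r′ (coherentWalk-tail cw) y<M′ 1+n≢n
     (coherentWalk-last o (suc m) r′ cw y<m) ,
   turned-end o m) ,
  subst (EndsT (suc m)) (sym (walkSteps-pt o (suc m) r′ y<M′)) (refl , refl)
  where
  cw = proj₁ (proj₁ qc)
  y<M′ = m<n⇒m<1+n (m<n⇒m<1+n y<m)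

toQ₁-sound : ∀ {m r} → 2 ≤ m → QCPath m r → QPath (suc m) (toQ₁ m r)
toQ₁-sound {m} {l ∷ r} 2≤m ((cw@(w , _) , o , refl) , endsQC) =
  subst (QPath M) (sym image≡)
    ((coherentWalk-extend o M′ (map τ r) cwτ (n<1+n m) (≢-sym 1+n≢n) compat , o , refl) ,
     subst (EndsQ M) (sym (trans (walkSteps-pt o M′ (map τ r) (n<1+n m)) (cong ((m , M , M′) ∷_) steps≡)))
       (refl , refl , runs-skip (walkSteps (pt o m M ∷ r)) endsQC))
  where
  M = suc m
  M′ = suc M
  τ = mapPoint (skip M)
  open Relabel (skip-mono M)
  image≡ : toQ₁ m (pt o m M ∷ r) ≡ pt o M M′ ∷ pt o m M′ ∷ map τ r
  image≡ = cong₂ (λ p p′ → p ∷ p′ ∷ map τ r) (skip-end o m) (skip-line o (n<1+n m))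
  cwτ : CoherentWalk (pt o m M′ ∷ map τ r)
  cwτ = subst (λ p → CoherentWalk (p ∷ map τ r)) (skip-line o (n<1+n m)) (coherentWalk-skip⁺ (s≤s 2≤m) cw)
  steps≡ : walkSteps (pt o m M′ ∷ map τ r) ≡ map (mapStep (skip M)) (walkSteps (pt o m M ∷ r))
  steps≡ = trans (cong (λ p → walkSteps (p ∷ map τ r)) (sym (skip-line o (n<1+n m))))
                 (walkSteps-map (pt o m M ∷ r))
  compat : All (λ s → Compatible s (m , M , M′)) (walkSteps (pt o m M′ ∷ map τ r))
  compat = subst (All (λ s → Compatible s (m , M , M′))) (sym steps≡)
             (All.map⁺ (All.map (λ {s} → compatible-skip {s} {b = M}) (walk-tgt≤ o r w (n≤1+n m) ≤-refl)))

toQ₂-sound : ∀ {m r} → QPath m r → QPath (suc m) (toQ₂ m r)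
toQ₂-sound {m} {r} q@((cw , end) , endsQ) =
  (coherentWalk-skip⁺ (qPath-3≤ q) cw , endsAt-map⁺ σm σM end) ,
  subst (EndsQ (suc m)) (sym (walkSteps-map r)) (endsQ-map⁺ σm σM (walkSteps r) endsQ)
  where
  open Relabel (skip-mono m)
  σm = skip-≥ {m} ≤-refl
  σM = skip-≥ {m} (n≤1+n m)

toC₁-sound : ∀ {m r} → TPath m r → CPath (suc m) (toC₁ m r)
toC₁-sound {m} t with tPath-view t
... | o , x , r′ , refl , x<M =
  subst (CPath M) (sym image≡)
    ((coherentWalk-extend′ o M′ (pt o M m ∷ pt o x m ∷ r′) cw₁ (n<1+n m) 1+n≢n compat₂ , turned-end o m) ,
     subst (EndsC M) (sym steps≡) (refl , refl , refl , refl))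
  where
  M = suc m
  M′ = suc M
  cw = proj₁ (proj₁ t)
  w = proj₁ cw
  image≡ : toC₁ m (pt o M m ∷ pt o x m ∷ r′) ≡ pt o M′ M ∷ pt o M′ m ∷ pt o M m ∷ pt o x m ∷ r′
  image≡ = cong₂ (λ p p′ → p ∷ p′ ∷ pt o M m ∷ pt o x m ∷ r′) (skip-end′ o m) (skip-line′ o (n<1+n m))
  cw₁ : CoherentWalk (pt o M′ m ∷ pt o M m ∷ pt o x m ∷ r′)
  cw₁ = coherentWalk-extend o m (pt o x m ∷ r′) cw (n<1+n M) (>⇒≢ (m<n⇒m<1+n (n<1+n m)))
          (All.map (λ {s} → compatible-vacuous {s} {b = M′}) (walk-tgt≤ o _ w ≤-refl (n≤1+n m)))
  compat₂ : All (λ s → Compatible s (m , M , M′)) (walkSteps (pt o M′ m ∷ pt o M m ∷ pt o x m ∷ r′))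
  compat₂ =
    subst (All (λ s → Compatible s (m , M , M′))) (sym (walkSteps-pt o m _ (n<1+n M))) ((λ _ → inj₁ refl) ∷
      subst (All (λ s → Compatible s (m , M , M′))) (sym (walkSteps-pt o m r′ x<M)) ((λ _ → inj₂ refl) ∷
        All.map (λ {s} → compatible-vacuous {s} {b = M}) (walk-tgt≤ o r′ (proj₂ w) (≤-pred x<M) ≤-refl)))
  steps≡ : walkSteps (pt o M′ M ∷ pt o M′ m ∷ pt o M m ∷ pt o x m ∷ r′) ≡
           (m , M , M′) ∷ (M , M′ , m) ∷ walkSteps (pt o M m ∷ pt o x m ∷ r′)
  steps≡ = trans (walkSteps-pt′ o M′ _ (n<1+n m)) (cong ((m , M , M′) ∷_) (walkSteps-pt o m _ (n<1+n M)))

toC₂-sound : ∀ {m r} → TPath m r → CPath (suc m) (toC₂ m r)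
toC₂-sound {m} t with tPath-view t
... | o , x , r′ , refl , x<M =
  subst (CPath M) (sym image≡)
    ((coherentWalk-extend′ o M′ (pt o x m ∷ r′) cw₁ (n<1+n m) 1+n≢n compat₂ , turned-end o m) ,
     subst (EndsC M) (sym steps≡) (refl , refl , refl , refl))
  where
  M = suc m
  M′ = suc M
  cw = proj₁ (proj₁ t)
  x<M′ = m<n⇒m<1+n x<M
  image≡ : toC₂ m (pt o M m ∷ pt o x m ∷ r′) ≡ pt o M′ M ∷ pt o M′ m ∷ pt o x m ∷ r′
  image≡ = cong₂ (λ p p′ → p ∷ p′ ∷ pt o x m ∷ r′) (skip-end′ o m) (skip-line′ o (n<1+n m))
  cw₁ : CoherentWalk (pt o M′ m ∷ pt o x m ∷ r′)
  cw₁ = coherentWalk-extend o m r′ (coherentWalk-tail cw) x<M′ (>⇒≢ (m<n⇒m<1+n (n<1+n m)))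
          (coherentWalk-last o m r′ cw x<M)
  compat₂ : All (λ s → Compatible s (m , M , M′)) (walkSteps (pt o M′ m ∷ pt o x m ∷ r′))
  compat₂ =
    subst (All (λ s → Compatible s (m , M , M′))) (sym (walkSteps-pt o m r′ x<M′)) ((λ _ → inj₁ refl) ∷
      All.map (λ {s} → compatible-vacuous {s} {b = M})
        (walk-tgt≤ o r′ (proj₂ (proj₁ cw)) (≤-pred x<M) ≤-refl))
  steps≡ : walkSteps (pt o M′ M ∷ pt o M′ m ∷ pt o x m ∷ r′) ≡
           (m , M , M′) ∷ (x , M′ , m) ∷ walkSteps (pt o x m ∷ r′)
  steps≡ = trans (walkSteps-pt′ o M′ _ (n<1+n m)) (cong ((m , M , M′) ∷_) (walkSteps-pt o m _ x<M′))

cPath-earlierCompat : ∀ o {m x y} r → CoherentWalk (pt o m (suc m) ∷ pt o y (suc m) ∷ pt o y x ∷ r) →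
                      y < m → x < suc m →
                      All (λ s → Compatible s (y , suc m , suc (suc m))) (walkSteps (pt o y x ∷ r))
cPath-earlierCompat o {m} {x} {y} r cw@(w , _) y<m x<M =
  compatibles-refix {b = m} {b′ = suc m} {c′ = suc (suc m)}
    (walk-tgt≤ o r (proj₂ (proj₂ w)) (<⇒≤ y<m) (≤-pred x<M))
    (All.tail (subst (All (λ s → Compatible s (y , m , suc m))) (walkSteps-pt′ o y r x<M)
                (coherentWalk-last o (suc m) (pt o y x ∷ r) cw y<m)))

toC₃-sound : ∀ {m r} → CPath m r → CPath (suc m) (toC₃ m r)
toC₃-sound {m} c with cPath-view c
... | o , x , y , r′ , refl , y<m , x<M =
  subst (CPath M) (sym image≡)
    ((coherentWalk-extend o M′ (pt o y M ∷ pt o y x ∷ r′) cw₁ y<M (≢-sym 1+n≢n) compat₂ , o , refl) ,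
     subst (EndsC M) (sym steps≡) (refl , refl , refl , refl))
  where
  M = suc m
  M′ = suc M
  cw = proj₁ (proj₁ c)
  y<M = m<n⇒m<1+n y<m
  image≡ : toC₃ m (pt o m M ∷ pt o y M ∷ pt o y x ∷ r′) ≡ pt o M M′ ∷ pt o y M′ ∷ pt o y M ∷ pt o y x ∷ r′
  image≡ = cong₂ (λ p p′ → p ∷ p′ ∷ pt o y M ∷ pt o y x ∷ r′) (skip-end o m) (skip-line o y<M)
  cw₁ : CoherentWalk (pt o y M′ ∷ pt o y M ∷ pt o y x ∷ r′)
  cw₁ = coherentWalk-extend′ o y (pt o y x ∷ r′) (coherentWalk-tail cw) (n<1+n M) (<⇒≢ (m<n⇒m<1+n y<M))
          (All.map (λ {s} → compatible-vacuous {s} {b = M′})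
            (walk-tgt≤ o _ (proj₂ (proj₁ cw)) (<⇒≤ y<M) ≤-refl))
  compat₂ : All (λ s → Compatible s (y , M , M′)) (walkSteps (pt o y M′ ∷ pt o y M ∷ pt o y x ∷ r′))
  compat₂ =
    subst (All (λ s → Compatible s (y , M , M′))) (sym (walkSteps-pt′ o y _ (n<1+n M))) ((λ _ → inj₁ refl) ∷
      subst (All (λ s → Compatible s (y , M , M′))) (sym (walkSteps-pt′ o y r′ x<M)) ((λ _ → inj₂ refl) ∷
        cPath-earlierCompat o r′ cw y<m x<M))
  steps≡ : walkSteps (pt o M M′ ∷ pt o y M′ ∷ pt o y M ∷ pt o y x ∷ r′) ≡
           (y , M , M′) ∷ (M , M′ , y) ∷ walkSteps (pt o y M ∷ pt o y x ∷ r′)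
  steps≡ = trans (walkSteps-pt o M′ _ y<M) (cong ((y , M , M′) ∷_) (walkSteps-pt′ o y _ (n<1+n M)))

toC₄-sound : ∀ {m r} → CPath m r → CPath (suc m) (toC₄ m r)
toC₄-sound {m} c with cPath-view c
... | o , x , y , r′ , refl , y<m , x<M =
  subst (CPath M) (sym image≡)
    ((coherentWalk-extend o M′ (pt o y x ∷ r′) cw₁ y<M (≢-sym 1+n≢n) compat₂ , o , refl) ,
     subst (EndsC M) (sym steps≡) (refl , refl , refl , refl))
  where
  M = suc m
  M′ = suc M
  cw = proj₁ (proj₁ c)
  y<M = m<n⇒m<1+n y<m
  x<M′ = m<n⇒m<1+n x<M
  image≡ : toC₄ m (pt o m M ∷ pt o y M ∷ pt o y x ∷ r′) ≡ pt o M M′ ∷ pt o y M′ ∷ pt o y x ∷ r′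
  image≡ = cong₂ (λ p p′ → p ∷ p′ ∷ pt o y x ∷ r′) (skip-end o m) (skip-line o y<M)
  cw₁ : CoherentWalk (pt o y M′ ∷ pt o y x ∷ r′)
  cw₁ = coherentWalk-extend′ o y r′ (coherentWalk-tail (coherentWalk-tail cw)) x<M′ (<⇒≢ (m<n⇒m<1+n y<M))
          (coherentWalk-last′ o y r′ (coherentWalk-tail cw) x<M)
  compat₂ : All (λ s → Compatible s (y , M , M′)) (walkSteps (pt o y M′ ∷ pt o y x ∷ r′))
  compat₂ = subst (All (λ s → Compatible s (y , M , M′))) (sym (walkSteps-pt′ o y r′ x<M′))
              ((λ _ → inj₁ refl) ∷ cPath-earlierCompat o r′ cw y<m x<M)
  steps≡ : walkSteps (pt o M M′ ∷ pt o y M′ ∷ pt o y x ∷ r′) ≡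
           (y , M , M′) ∷ (x , M′ , y) ∷ walkSteps (pt o y x ∷ r′)
  steps≡ = trans (walkSteps-pt o M′ _ y<M) (cong ((y , M , M′) ∷_) (walkSteps-pt′ o y _ x<M′))


-- Every path of size n + 1 arises

t₁-preimage : ∀ o {m} r → CoherentWalk (pt o (suc (suc m)) (suc m) ∷ pt o m (suc m) ∷ r) →
              Image toT₁ (Path m) (pt o (suc (suc m)) (suc m) ∷ pt o m (suc m) ∷ r)
t₁-preimage o {m} r cw =
  pt o m (suc m) ∷ r , (coherentWalk-tail cw , o , refl) , cong (_∷ pt o m (suc m) ∷ r) (raise-end o m)

t₂-preimage : ∀ o {m x} r → 2 ≤ m → CoherentWalk (pt o (suc (suc m)) (suc m) ∷ pt o x (suc m) ∷ r) → x < m →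
              Image toT₂ (QCPath m) (pt o (suc (suc m)) (suc m) ∷ pt o x (suc m) ∷ r)
t₂-preimage o {m} {x} r 2≤m cw x<m = P , (pathP , endsQC) , cong (_∷ pt o x (suc m) ∷ r) (raise-end o m)
  where
  P = pt o m (suc m) ∷ pt o x (suc m) ∷ r
  pathP : Path m P
  pathP = coherentWalk-extend o (suc m) r (coherentWalk-tail cw) x<m (<⇒≢ (n<1+n m))
            (coherentWalk-last o (suc m) r cw (m<n⇒m<1+n (m<n⇒m<1+n x<m))) ,
          o , refl
  endsQC : EndsQC m (walkSteps P)
  endsQC = subst (EndsQC m) (sym (walkSteps-pt o (suc m) r x<m))
             (refl , refl , walk-lineEntry {e = x} {o} {r = r} (s≤s 2≤m) (proj₁ (coherentWalk-tail cw)) refl)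

toT-complete : ∀ {m r} → 2 ≤ m → TPath (suc m) r → Image toT₁ (Path m) r ⊎ Image toT₂ (QCPath m) r
toT-complete {m} 2≤m t with tPath-view t
... | o , x , r′ , refl , x<M′ with x ≟ m
...   | yes refl = inj₁ (t₁-preimage o r′ (proj₁ (proj₁ t)))
...   | no x≢m   = inj₂ (t₂-preimage o r′ 2≤m (proj₁ (proj₁ t)) (≤∧≢⇒< (≤-pred x<M) x≢m))
  where
  x<M = ≤∧≢⇒< (≤-pred x<M′) (offDiagonal-pt⁻ o (All.head (All.tail (proj₁ (proj₂ (proj₁ (proj₁ t)))))))

q₁-preimage : ∀ o {m y′} r → 2 ≤ m →
              CoherentWalk (pt o (suc m) (suc (suc m)) ∷ pt o m (suc (suc m)) ∷ pt o y′ (suc (suc m)) ∷ r) →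
              y′ < m →
              Image (toQ₁ m) (QCPath m)
                (pt o (suc m) (suc (suc m)) ∷ pt o m (suc (suc m)) ∷ pt o y′ (suc (suc m)) ∷ r)
q₁-preimage o {m} {y′} r 2≤m cw y′<m = P , (pathP , endsQC) , image≡
  where
  M = suc m
  M′ = suc M
  T = pt o m M′ ∷ pt o y′ M′ ∷ r
  open Relabel (skip-mono M)
  τm = skip-< {M} (n<1+n m)
  τM = skip-≥ {M} ≤-refl
  T-avoids : All (Avoids M) T
  T-avoids = avoids-pt o (<⇒≢ (n<1+n m)) 1+n≢n
             ∷ coherentWalk-avoids o r cw y′<m (n<1+n m) (n<1+n m) (≢-sym 1+n≢n) (s≤s 2≤m)
  P = map (mapPoint (unskip M)) T
  P≡ : map (mapPoint (skip M)) P ≡ T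
  P≡ = skip-unskip-points M T-avoids
  head≡ : mapPoint (unskip M) (pt o m M′) ≡ pt o m M
  head≡ = mapPoint-pt⁻ o m M (trans (List.∷-injectiveˡ P≡) (cong₂ (pt o) (sym τm) (sym τM)))
  pathP : Path m P
  pathP = coherentWalk-skip⁻ (s≤s 2≤m) (subst CoherentWalk (sym P≡) (coherentWalk-tail cw)) , o , head≡
  steps≡ : map (mapStep (skip M)) (walkSteps P) ≡ (y′ , m , M′) ∷ walkSteps (pt o y′ M′ ∷ r)
  steps≡ = trans (sym (walkSteps-map P)) (trans (cong walkSteps P≡) (walkSteps-pt o M′ r y′<m))
  notT : ∀ ss → map (mapStep (skip M)) ss ≡ (y′ , m , M′) ∷ walkSteps (pt o y′ M′ ∷ r) → ¬ EndsT m ss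
  notT (s ∷ _) e (tgt≡M , _) =
    >⇒≢ (m<n⇒m<1+n (n<1+n m))
      (trans (sym τM) (trans (cong (skip M) (sym tgt≡M)) (cong tgt (List.∷-injectiveˡ e))))
  endsQC : EndsQC m (walkSteps P)
  endsQC with path-classify 2≤m pathP
  ... | inj₁ endsT  = ⊥-elim (notT (walkSteps P) steps≡ endsT)
  ... | inj₂ endsQC = endsQC
  image≡ : toQ₁ m P ≡ pt o M M′ ∷ T
  image≡ = cong₂ _∷_ (trans (cong (mapPoint (skip m)) head≡) (skip-end o m)) P≡

q₂-preimage : ∀ o {m y′ y} r →
              QPath (suc m) (pt o (suc m) (suc (suc m)) ∷ pt o y (suc (suc m)) ∷ pt o y′ (suc (suc m)) ∷ r) →
              1 ≤ y′ → y′ < y → y < m →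
              Image (toQ₂ m) (QPath m)
                (pt o (suc m) (suc (suc m)) ∷ pt o y (suc (suc m)) ∷ pt o y′ (suc (suc m)) ∷ r)
q₂-preimage o {m} {y′} {y} r ((cw , end) , endsQ) 1≤y′ y′<y y<m = P , ((pathP , endP) , endsQP) , P≡
  where
  M = suc m
  M′ = suc M
  R = pt o M M′ ∷ pt o y M′ ∷ pt o y′ M′ ∷ r
  3≤m = ≤-trans (s≤s (≤-trans (s≤s 1≤y′) y′<y)) y<m
  open Relabel (skip-mono m)
  σm = skip-≥ {m} ≤-refl
  σM = skip-≥ {m} (n≤1+n m)
  M′≢m = >⇒≢ (m<n⇒m<1+n (n<1+n m))
  R-avoids : All (Avoids m) R
  R-avoids = avoids-pt o 1+n≢n M′≢m ∷ avoids-pt o (<⇒≢ y<m) M′≢m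
             ∷ coherentWalk-avoids o r cw y′<y (m<n⇒m<1+n y<m) y<m (≢-sym M′≢m) 3≤m
  P = map (mapPoint (unskip m)) R
  P≡ : map (mapPoint (skip m)) P ≡ R
  P≡ = skip-unskip-points m R-avoids
  pathP : CoherentWalk P
  pathP = coherentWalk-skip⁻ 3≤m (subst CoherentWalk (sym P≡) cw)
  endP : EndsAt m P
  endP = endsAt-map⁻ σm σM {P} (subst (EndsAt M) (sym P≡) end)
  endsQP : EndsQ m (walkSteps P)
  endsQP = endsQ-map⁻ σm σM (walkSteps P)
             (subst (EndsQ M) (trans (cong walkSteps (sym P≡)) (walkSteps-map P)) endsQ)

toQ-complete : ∀ {m r} → 2 ≤ m → QPath (suc m) r → Image (toQ₁ m) (QCPath m) r ⊎ Image (toQ₂ m) (QPath m) r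
toQ-complete {m} 2≤m q with qPath-view q
... | o , y′ , y , r′ , refl , 1≤y′ , y′<y , y<M with y ≟ m
...   | yes refl = inj₁ (q₁-preimage o r′ 2≤m (proj₁ (proj₁ q)) y′<y)
...   | no y≢m   = inj₂ (q₂-preimage o r′ q 1≤y′ y′<y (≤∧≢⇒< (≤-pred y<M) y≢m))

c₁-preimage : ∀ o {m} r → 2 ≤ m →
              CoherentWalk (pt o (suc m) (suc (suc m)) ∷ pt o m (suc (suc m)) ∷ pt o m (suc m) ∷ r) →
              Image (toC₁ m) (TPath m)
                (pt o (suc m) (suc (suc m)) ∷ pt o m (suc (suc m)) ∷ pt o m (suc m) ∷ r)
c₁-preimage o {m} r 2≤m cw = P , (pathP , endsT) , image≡
  where
  M = suc m
  M′ = suc M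
  P = pt o m M ∷ r
  pathP : Path m P
  pathP = coherentWalk-tail (coherentWalk-tail cw) , o , refl
  earlier : All (λ s → Compatible s (m , M , M′)) (walkSteps P)
  earlier = All.tail (subst (All (λ s → Compatible s (m , M , M′))) (walkSteps-pt′ o m r (n<1+n M))
                       (coherentWalk-last o M′ P cw (n<1+n m)))
  endsT : EndsT m (walkSteps P)
  endsT with path-classify 2≤m pathP
  ... | inj₁ endsT  = endsT
  ... | inj₂ endsQC =
    ⊥-elim (runs-incompatible {t = m , M , M′} (walkSteps P) endsQC (path-inRange pathP) earlier refl
              (n<1+n m) (≢-sym 1+n≢n))
  image≡ : toC₁ m P ≡ pt o M M′ ∷ pt o m M′ ∷ P
  image≡ = cong₂ (λ p p′ → p ∷ p′ ∷ P) (skip-end o m)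
                                        (skip-line o (n<1+n m))

c₂-preimage : ∀ o {m x} r →
              CoherentWalk (pt o (suc m) (suc (suc m)) ∷ pt o m (suc (suc m)) ∷ pt o m x ∷ r) → x < suc m →
              Image (toC₂ m) (TPath m) (pt o (suc m) (suc (suc m)) ∷ pt o m (suc (suc m)) ∷ pt o m x ∷ r)
c₂-preimage o {m} {x} r cw x<M = P , (pathP , endsT) , image≡
  where
  M = suc m
  M′ = suc M
  P = pt o m M ∷ pt o m x ∷ r
  pathP : Path m P
  pathP = coherentWalk-extend′ o m r (coherentWalk-tail (coherentWalk-tail cw)) x<M (<⇒≢ (n<1+n m))
            (coherentWalk-last′ o m r (coherentWalk-tail cw) (m<n⇒m<1+n x<M)) ,
          o , refl
  endsT : EndsT m (walkSteps P)
  endsT = subst (EndsT m) (sym (walkSteps-pt′ o m r x<M)) (refl , refl)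
  image≡ : toC₂ m P ≡ pt o M M′ ∷ pt o m M′ ∷ pt o m x ∷ r
  image≡ = cong₂ (λ p p′ → p ∷ p′ ∷ pt o m x ∷ r) (skip-end o m)
                                                   (skip-line o (n<1+n m))

c₃-preimage : ∀ o {m y} r → 2 ≤ m →
              CoherentWalk (pt o (suc m) (suc (suc m)) ∷ pt o y (suc (suc m)) ∷ pt o y (suc m) ∷ r) → y < m →
              Image (toC₃ m) (CPath m)
                (pt o (suc m) (suc (suc m)) ∷ pt o y (suc (suc m)) ∷ pt o y (suc m) ∷ r)
c₃-preimage o {m} {y} r 2≤m cw y<m = P , (pathP , endsC) , image≡
  where
  M = suc m
  M′ = suc M
  y<M = m<n⇒m<1+n y<m
  P = pt o m M ∷ pt o y M ∷ r
  earlier : All (λ s → Compatible s (y , M , M′)) (walkSteps (pt o y M ∷ r))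
  earlier = All.tail (subst (All (λ s → Compatible s (y , M , M′))) (walkSteps-pt′ o y r (n<1+n M))
                       (coherentWalk-last o M′ (pt o y M ∷ r) cw y<M))
  w = proj₁ (coherentWalk-tail (coherentWalk-tail cw))
  pathP : Path m P
  pathP = coherentWalk-extend o M r (coherentWalk-tail (coherentWalk-tail cw)) y<m (<⇒≢ (n<1+n m))
            (compatibles-refix {b = M} {b′ = m} {c′ = M} (walk-tgt≤ o r w (<⇒≤ y<M) ≤-refl) earlier) ,
          o , refl
  steps≡ : walkSteps P ≡ (y , m , M) ∷ walkSteps (pt o y M ∷ r)
  steps≡ = walkSteps-pt o M r y<m
  notQ : ¬ EndsQ m (walkSteps P)
  notQ endsQ =
    runs-incompatible {t = y , M , M′} (walkSteps (pt o y M ∷ r))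
      (proj₂ (proj₂ (subst (EndsQ m) steps≡ endsQ)))
      (All.tail (subst (All (InRange M)) steps≡ (path-inRange pathP))) earlier refl y<M (≢-sym 1+n≢n)
  endsC : EndsC m (walkSteps P)
  endsC with path-classify 2≤m pathP
  ... | inj₁ endsT = ⊥-elim (<⇒≢ (n<1+n m) (proj₁ (subst (EndsT m) steps≡ endsT)))
  ... | inj₂ endsQC with endsQC-split (walkSteps P) endsQC
  ...   | inj₁ endsQ = ⊥-elim (notQ endsQ)
  ...   | inj₂ endsC = endsC
  image≡ : toC₃ m P ≡ pt o M M′ ∷ pt o y M′ ∷ pt o y M ∷ r
  image≡ = cong₂ (λ p p′ → p ∷ p′ ∷ pt o y M ∷ r) (skip-end o m)
                                                   (skip-line o y<M)

c₄-preimage : ∀ o {m x y} r →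
              CoherentWalk (pt o (suc m) (suc (suc m)) ∷ pt o y (suc (suc m)) ∷ pt o y x ∷ r) →
              y < m → x < suc m →
              Image (toC₄ m) (CPath m) (pt o (suc m) (suc (suc m)) ∷ pt o y (suc (suc m)) ∷ pt o y x ∷ r)
c₄-preimage o {m} {x} {y} r cw y<m x<M = P , ((cw₂ , o , refl) , endsC) , image≡
  where
  M = suc m
  M′ = suc M
  y<M = m<n⇒m<1+n y<m
  x<M′ = m<n⇒m<1+n x<M
  P = pt o m M ∷ pt o y M ∷ pt o y x ∷ r
  w = proj₁ (coherentWalk-tail (coherentWalk-tail cw))
  earlier : All (λ s → Compatible s (y , M , M′)) (walkSteps (pt o y x ∷ r))
  earlier = All.tail (subst (All (λ s → Compatible s (y , M , M′))) (walkSteps-pt′ o y r x<M′)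
                       (coherentWalk-last o M′ (pt o y x ∷ r) cw y<M))
  cw₁ : CoherentWalk (pt o y M ∷ pt o y x ∷ r)
  cw₁ = coherentWalk-extend′ o y r (coherentWalk-tail (coherentWalk-tail cw)) x<M (<⇒≢ y<M)
          (coherentWalk-last′ o y r (coherentWalk-tail cw) x<M′)
  compat₂ : All (λ s → Compatible s (y , m , M)) (walkSteps (pt o y M ∷ pt o y x ∷ r))
  compat₂ = subst (All (λ s → Compatible s (y , m , M))) (sym (walkSteps-pt′ o y r x<M))
              ((λ _ → inj₁ refl) ∷
               compatibles-refix {b = M} {b′ = m} {c′ = M} (walk-tgt≤ o r w (<⇒≤ y<M) (<⇒≤ x<M)) earlier)
  cw₂ : CoherentWalk P
  cw₂ = coherentWalk-extend o M (pt o y x ∷ r) cw₁ y<m (<⇒≢ (n<1+n m)) compat₂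
  endsC : EndsC m (walkSteps P)
  endsC = subst (EndsC m)
            (sym (trans (walkSteps-pt o M _ y<m) (cong ((y , m , M) ∷_) (walkSteps-pt′ o y r x<M))))
            (refl , refl , refl , refl)
  image≡ : toC₄ m P ≡ pt o M M′ ∷ pt o y M′ ∷ pt o y x ∷ r
  image≡ = cong₂ (λ p p′ → p ∷ p′ ∷ pt o y x ∷ r) (skip-end o m)
                                                   (skip-line o y<M)

toC-complete : ∀ {m r} → 2 ≤ m → CPath (suc m) r →
               Image (toC₁ m) (TPath m) r ⊎ Image (toC₂ m) (TPath m) r ⊎
               Image (toC₃ m) (CPath m) r ⊎ Image (toC₄ m) (CPath m) r
toC-complete {m} 2≤m c with cPath-view c
... | o , x , y , r′ , refl , y<M , x<M′ with y ≟ m | x ≟ suc m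
...   | yes refl | yes refl = inj₁ (c₁-preimage o r′ 2≤m (proj₁ (proj₁ c)))
...   | yes refl | no x≢M   = inj₂ (inj₁ (c₂-preimage o r′ (proj₁ (proj₁ c)) (≤∧≢⇒< (≤-pred x<M′) x≢M)))
...   | no y≢m   | yes refl =
  inj₂ (inj₂ (inj₁ (c₃-preimage o r′ 2≤m (proj₁ (proj₁ c)) (≤∧≢⇒< (≤-pred y<M) y≢m))))
...   | no y≢m   | no x≢M   =
  inj₂ (inj₂ (inj₂ (c₄-preimage o r′ (proj₁ (proj₁ c)) (≤∧≢⇒< (≤-pred y<M) y≢m) (≤∧≢⇒< (≤-pred x<M′) x≢M))))


toT₁-injective : ∀ {a a′} → toT₁ a ≡ toT₁ a′ → a ≡ a′
toT₁-injective {[]}    {[]}     _ = refl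
toT₁-injective {_ ∷ _} {_ ∷ _}  e = List.∷-injectiveʳ e

toT₂-injective : ∀ {m} → InjectiveOn (Path m) toT₂
toT₂-injective {m} {l ∷ r} {l′ ∷ r′} (_ , o , refl) (_ , o′ , refl) e
  rewrite raise-end o m | raise-end o′ m with pt-≡ (List.∷-injectiveˡ e)
... | inj₁ (refl , _ , _) = cong (pt o m (suc m) ∷_) (List.∷-injectiveʳ e)
... | inj₂ (_ , M′≡M , _) = ⊥-elim (1+n≢n M′≡M)

toQ₁-injective : ∀ {m a a′} → toQ₁ m a ≡ toQ₁ m a′ → a ≡ a′
toQ₁-injective {m} {[]}    {[]}    _ = refl
toQ₁-injective {m} {_ ∷ _} {_ ∷ _} e = List.map-injective mapPoint-injective (List.∷-injectiveʳ e)
  where open Relabel (skip-mono (suc m))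

toQ₂-injective : ∀ {m a a′} → toQ₂ m a ≡ toQ₂ m a′ → a ≡ a′
toQ₂-injective {m} = List.map-injective mapPoint-injective
  where open Relabel (skip-mono m)

toC₁-injective : ∀ {m a a′} → toC₁ m a ≡ toC₁ m a′ → a ≡ a′
toC₁-injective {m} {[]}    {[]}    _ = refl
toC₁-injective {m} {_ ∷ _} {_ ∷ _} e = List.∷-injectiveʳ (List.∷-injectiveʳ e)

toC₂-injective : ∀ {m a a′} → toC₂ m a ≡ toC₂ m a′ → a ≡ a′
toC₂-injective {m} {[]}    {[]}    _ = refl
toC₂-injective {m} {_ ∷ _} {_ ∷ _} e =
  cong₂ _∷_ (mapPoint-injective (List.∷-injectiveˡ e)) (List.∷-injectiveʳ (List.∷-injectiveʳ e))
  where open Relabel (skip-mono m)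

toC₃-injective : ∀ {m} → InjectiveOn (CPath m) (toC₃ m)
toC₃-injective {m} c c′ e with cPath-view c | cPath-view c′
... | _ , _ , _ , _ , refl , _ | _ , _ , _ , _ , refl , _ =
  cong₂ _∷_ (mapPoint-injective (List.∷-injectiveˡ e)) (List.∷-injectiveʳ (List.∷-injectiveʳ e))
  where open Relabel (skip-mono m)

toC₄-injective : ∀ {m} → InjectiveOn (CPath m) (toC₄ m)
toC₄-injective {m} c c′ e with cPath-view c | cPath-view c′
... | _ , _ , _ , _ , refl , _ | _ , _ , _ , _ , refl , _ =
  cong₂ _∷_ (Relabel.mapPoint-injective (skip-mono m) (List.∷-injectiveˡ e))
    (cong₂ _∷_ (Relabel.mapPoint-injective (skip-mono (suc m)) (List.∷-injectiveˡ (List.∷-injectiveʳ e)))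
               (List.∷-injectiveʳ (List.∷-injectiveʳ e)))

toT₁≢toT₂ : ∀ {m a a′} → Path m a → QCPath m a′ → toT₁ a ≢ toT₂ a′
toT₁≢toT₂ {m} {l ∷ r} (_ , o , refl) qc e with qcPath-view qc
... | _ , _ , _ , refl , y<m with pt-≡ (List.∷-injectiveˡ (List.∷-injectiveʳ e))
...   | inj₁ (_ , m≡y , _) = <⇒≢ y<m (sym m≡y)
...   | inj₂ (_ , m≡M , _) = <⇒≢ (n<1+n m) m≡M

toQ₁≢toQ₂ : ∀ {m a a′} → QCPath m a → QPath m a′ → toQ₁ m a ≢ toQ₂ m a′
toQ₁≢toQ₂ {m} {l ∷ r} ((_ , o , refl) , _) q e with qPath-view q
... | o′ , _ , y , _ , refl , _ , _ , y<m
  with pt-≡ (trans (sym (skip-line o (n<1+n m)))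
              (trans (List.∷-injectiveˡ (List.∷-injectiveʳ e))
                     (mapPoint-pt′ (skip m) o′ (skip-< y<m) (skip-≥ (n≤1+n m)))))
...   | inj₁ (_ , m≡y , _) = <⇒≢ y<m (sym m≡y)
...   | inj₂ (_ , m≡M′ , _) = <⇒≢ (m<n⇒m<1+n (n<1+n m)) m≡M′

toC₁≢toC₂ : ∀ {m a a′} → TPath m a → TPath m a′ → toC₁ m a ≢ toC₂ m a′
toC₁≢toC₂ {m} t t′ e with tPath-view t | tPath-view t′
... | _ , _ , _ , refl , _ | _ , _ , _ , refl , x<M
  with pt-≡ (List.∷-injectiveˡ (List.∷-injectiveʳ (List.∷-injectiveʳ e)))
...   | inj₁ (_ , M≡x , _) = <⇒≢ x<M (sym M≡x)
...   | inj₂ (_ , M≡m , _) = 1+n≢n M≡m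

fromT≢fromC : ∀ {m} (f g : List Point → List Point) →
              (∀ p r → ∃[ r″ ] f (p ∷ r) ≡ mapPoint (skip m) p ∷ mapPoint (skip (suc m)) p ∷ r″) →
              (∀ l p r → ∃[ r″ ] g (l ∷ p ∷ r) ≡ mapPoint (skip m) l ∷ mapPoint (skip (suc m)) p ∷ r″) →
              ∀ {a a′} → TPath m a → CPath m a′ → f a ≢ g a′
fromT≢fromC {m} f g f≡ g≡ t c e with tPath-view t | cPath-view c
... | o , x , r , refl , _ | o′ , x′ , y , r′ , refl , y<m , _
  with pt-≡ {o} {o′} (Relabel.mapPoint-injective (skip-mono (suc m))
              (List.∷-injectiveˡ (List.∷-injectiveʳ
                (trans (sym (proj₂ (f≡ _ (pt o x m ∷ r)))) (trans e (proj₂ (g≡ _ _ (pt o′ y x′ ∷ r′))))))))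
...   | inj₁ (_ , M≡y , _) = <-asym y<m (subst (m <_) M≡y (n<1+n m))
...   | inj₂ (_ , _ , m≡y) = <⇒≢ y<m (sym m≡y)

toC₃≢toC₄ : ∀ {m a a′} → CPath m a → CPath m a′ → toC₃ m a ≢ toC₄ m a′
toC₃≢toC₄ {m} c c′ e with cPath-view c | cPath-view c′
... | _ , _ , _ , _ , refl , _ | _ , _ , _ , _ , refl , y<m , x<M
  with pt-≡ (List.∷-injectiveˡ (List.∷-injectiveʳ (List.∷-injectiveʳ e)))
...   | inj₁ (_ , _ , M≡x) = <⇒≢ x<M (sym M≡x)
...   | inj₂ (_ , _ , M≡y) = <-asym y<m (subst (m <_) M≡y (n<1+n m))


enumerates-qcPaths : ∀ {m qs cs} → Enumerates (QPath m) qs → Enumerates (CPath m) cs →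
                     Enumerates (QCPath m) (qs ++ cs)
enumerates-qcPaths eQ eC =
  enumerates-cong [ (λ (p , q) → p , endsQ⇒endsQC _ q) , (λ (p , c) → p , endsC⇒endsQC _ c) ]
    (λ (p , qc) → Sum.map (p ,_) (p ,_) (endsQC-split _ qc))
    (enumerates-++ eQ eC (λ (p , q) (_ , c) → endsQ-endsC-disjoint _ (path-inRange p) q c))

enumerates-paths : ∀ {m ts qcs} → 2 ≤ m → Enumerates (TPath m) ts → Enumerates (QCPath m) qcs →
                   Enumerates (Path m) (ts ++ qcs)
enumerates-paths 2≤m eT eQC =
  enumerates-cong [ proj₁ , proj₁ ] (λ p → Sum.map (p ,_) (p ,_) (path-classify 2≤m p))
    (enumerates-++ eT eQC (λ (_ , t) (_ , qc) → endsT-endsQC-disjoint _ t qc))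

enumerates-tPaths : ∀ {m ps qcs} → 2 ≤ m → Enumerates (Path m) ps → Enumerates (QCPath m) qcs →
                    Enumerates (TPath (suc m)) (map toT₁ ps ++ map toT₂ qcs)
enumerates-tPaths 2≤m eP eQC =
  enumerates-cong [ image⊆ toT₁-sound , image⊆ toT₂-sound ] (toT-complete 2≤m)
    (enumerates-++ (enumerates-map (λ _ _ → toT₁-injective) eP)
                   (enumerates-map (λ qc qc′ → toT₂-injective (proj₁ qc) (proj₁ qc′)) eQC)
                   (images-disjoint toT₁≢toT₂))

enumerates-qPaths : ∀ {m qs qcs} → 2 ≤ m → Enumerates (QCPath m) qcs → Enumerates (QPath m) qs →
                    Enumerates (QPath (suc m)) (map (toQ₁ m) qcs ++ map (toQ₂ m) qs)
enumerates-qPaths 2≤m eQC eQ =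
  enumerates-cong [ image⊆ (toQ₁-sound 2≤m) , image⊆ toQ₂-sound ] (toQ-complete 2≤m)
    (enumerates-++ (enumerates-map (λ _ _ → toQ₁-injective) eQC) (enumerates-map (λ _ _ → toQ₂-injective) eQ)
                   (images-disjoint toQ₁≢toQ₂))

enumerates-cPaths : ∀ {m ts cs} → 2 ≤ m → Enumerates (TPath m) ts → Enumerates (CPath m) cs →
                    Enumerates (CPath (suc m))
                      (map (toC₁ m) ts ++ map (toC₂ m) ts ++ map (toC₃ m) cs ++ map (toC₄ m) cs)
enumerates-cPaths {m} 2≤m eT eC =
  enumerates-cong [ image⊆ toC₁-sound , [ image⊆ toC₂-sound , [ image⊆ toC₃-sound , image⊆ toC₄-sound ] ] ]
    (toC-complete 2≤m)
    (enumerates-++ (enumerates-map (λ _ _ → toC₁-injective) eT)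
      (enumerates-++ (enumerates-map (λ _ _ → toC₂-injective) eT)
        (enumerates-++ (enumerates-map toC₃-injective eC) (enumerates-map toC₄-injective eC)
          (images-disjoint toC₃≢toC₄))
        (λ i₂ → [ images-disjoint C₂≢C₃ i₂ , images-disjoint C₂≢C₄ i₂ ]))
      (λ i₁ → [ images-disjoint toC₁≢toC₂ i₁ , [ images-disjoint C₁≢C₃ i₁ , images-disjoint C₁≢C₄ i₁ ] ]))
  where
  C₁≢C₃ : ∀ {a a′} → TPath m a → CPath m a′ → toC₁ m a ≢ toC₃ m a′
  C₁≢C₃ = fromT≢fromC (toC₁ m) (toC₃ m) (λ _ _ → _ , refl) (λ _ _ _ → _ , refl)
  C₁≢C₄ : ∀ {a a′} → TPath m a → CPath m a′ → toC₁ m a ≢ toC₄ m a′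
  C₁≢C₄ = fromT≢fromC (toC₁ m) (toC₄ m) (λ _ _ → _ , refl) (λ _ _ _ → _ , refl)
  C₂≢C₃ : ∀ {a a′} → TPath m a → CPath m a′ → toC₂ m a ≢ toC₃ m a′
  C₂≢C₃ = fromT≢fromC (toC₂ m) (toC₃ m) (λ _ _ → _ , refl) (λ _ _ _ → _ , refl)
  C₂≢C₄ : ∀ {a a′} → TPath m a → CPath m a′ → toC₂ m a ≢ toC₄ m a′
  C₂≢C₄ = fromT≢fromC (toC₂ m) (toC₄ m) (λ _ _ → _ , refl) (λ _ _ _ → _ , refl)

record Census : Set where
  constructor census
  field
    tPaths qPaths cPaths : List (List Point)

open Census

next : ℕ → Census → Census
next m (census ts qs cs) =
  census (map toT₁ (ts ++ qs ++ cs) ++ map toT₂ (qs ++ cs))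
         (map (toQ₁ m) (qs ++ cs) ++ map (toQ₂ m) qs)
         (map (toC₁ m) ts ++ map (toC₂ m) ts ++ map (toC₃ m) cs ++ map (toC₄ m) cs)

Enumerated : ℕ → Census → Set
Enumerated m X =
  Enumerates (TPath m) (tPaths X) × Enumerates (QPath m) (qPaths X) × Enumerates (CPath m) (cPaths X)

next-enumerated : ∀ {m X} → 2 ≤ m → Enumerated m X → Enumerated (suc m) (next m X)
next-enumerated {m} {census ts qs cs} 2≤m (eT , eQ , eC) =
  enumerates-tPaths 2≤m (enumerates-paths 2≤m eT eQC) eQC ,
  enumerates-qPaths 2≤m eQC eQ ,
  enumerates-cPaths 2≤m eT eC
  where
  eQC : Enumerates (QCPath m) (qs ++ cs)
  eQC = enumerates-qcPaths eQ eC

tPath₃ cPath₃ : List Point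
tPath₃ = (2 , 3) ∷ (2 , 1) ∷ []
cPath₃ = (3 , 2) ∷ (3 , 1) ∷ (2 , 1) ∷ []

walk-fromStart : ∀ {r} → Walk ((2 , 1) ∷ r) → r ≡ []
walk-fromStart {[]} _ = refl
walk-fromStart {_ ∷ _} (inj₁ (_ , y<1) , w) with walk-≥ w
... | (_ , 1≤y) ∷ _ = ⊥-elim (<⇒≱ y<1 1≤y)
walk-fromStart {_ ∷ _} (inj₂ (_ , x<2) , w) with walk-≥ w
... | (2≤x , _) ∷ _ = ⊥-elim (<⇒≱ x<2 2≤x)

walk-from31 : ∀ {r} → Walk ((3 , 1) ∷ r) → r ≡ (2 , 1) ∷ []
walk-from31 {_ ∷ _} (inj₁ (_ , d<1) , w) with walk-≥ w
... | (_ , 1≤d) ∷ _ = ⊥-elim (<⇒≱ d<1 1≤d)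
walk-from31 {_ ∷ _} (inj₂ (refl , s≤s (s≤s (s≤s z≤n))) , w) with walk-≥ w
... | (s≤s (s≤s z≤n) , _) ∷ _ = cong (_ ∷_) (walk-fromStart w)
walk-from31 {_ ∷ _} (inj₂ (refl , s≤s (s≤s z≤n)) , w) with walk-≥ w
... | (s≤s () , _) ∷ _
walk-from31 {_ ∷ _} (inj₂ (refl , s≤s z≤n) , w) with walk-≥ w
... | (() , _) ∷ _

-- Matching on the proofs of the coordinate bounds enumerates the possible earlier points.
path₃-cases : ∀ {r} → Path 2 r → r ≡ tPath₃ ⊎ r ≡ cPath₃
path₃-cases {_ ∷ []} ((refl , _) , true  , ())
path₃-cases {_ ∷ []} ((refl , _) , false , ())
path₃-cases {_ ∷ _ ∷ r} (((q→l , w) , _ ∷ q-off ∷ _ , _) , true , refl) with q→l | walk-≥ w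
... | inj₂ (_ , a<2)                       | (2≤a , _) ∷ _    = ⊥-elim (<⇒≱ a<2 2≤a)
... | inj₁ (refl , s≤s z≤n)                | (_ , ()) ∷ _
... | inj₁ (refl , s≤s (s≤s z≤n))          | _               = inj₁ (cong (λ r → _ ∷ _ ∷ r) (walk-fromStart w))
... | inj₁ (refl , s≤s (s≤s (s≤s z≤n)))    | _               = ⊥-elim (q-off refl)
path₃-cases {_ ∷ _ ∷ r} (((q→l , w) , _ ∷ q-off ∷ _ , _) , false , refl) with q→l | walk-≥ w
... | inj₁ (refl , s≤s z≤n)                | (_ , ()) ∷ _
... | inj₁ (refl , s≤s (s≤s z≤n))          | _               = inj₂ (cong (λ r → _ ∷ _ ∷ r) (walk-from31 w))
... | inj₂ (refl , s≤s (s≤s (s≤s z≤n)))    | _               = ⊥-elim (q-off refl)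
... | inj₂ (refl , s≤s (s≤s z≤n))          | (s≤s () , _) ∷ _
... | inj₂ (refl , s≤s z≤n)                | (() , _) ∷ _

census₃ : Census
census₃ = census (tPath₃ ∷ []) [] (cPath₃ ∷ [])

census₃-enumerated : Enumerated 2 census₃
census₃-enumerated = eT , eQ , eC
  where
  tPath₃-isT : TPath 2 tPath₃
  tPath₃-isT =
    (((inj₁ (refl , s≤s (s≤s z≤n)) , refl) , (λ ()) ∷ (λ ()) ∷ [] , [] ∷ []) , true , refl) , refl , refl
  cPath₃-isC : CPath 2 cPath₃
  cPath₃-isC =
    (((inj₁ (refl , s≤s (s≤s z≤n)) , inj₂ (refl , s≤s (s≤s (s≤s z≤n))) , refl) ,
      (λ ()) ∷ (λ ()) ∷ (λ ()) ∷ [] , ((λ _ → inj₁ refl) ∷ []) ∷ [] ∷ []) ,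
     false , refl) ,
    refl , refl , refl , refl
  eT : Enumerates (TPath 2) (tPath₃ ∷ [])
  eT = record { unique = [] ∷ [] ; complete = only-tPath₃ ; sound = λ { (here refl) → tPath₃-isT } }
    where
    only-tPath₃ : ∀ {r} → TPath 2 r → r ∈ tPath₃ ∷ []
    only-tPath₃ t with path₃-cases (proj₁ t)
    ... | inj₁ refl = here refl
    ... | inj₂ refl = ⊥-elim (<⇒≢ (n<1+n 2) (proj₁ (proj₂ t)))
  eQ : Enumerates (QPath 2) []
  eQ = record { unique = [] ; complete = λ q → ⊥-elim (1+n≰n (qPath-3≤ q)) ; sound = λ () }
  eC : Enumerates (CPath 2) (cPath₃ ∷ [])
  eC = record { unique = [] ∷ [] ; complete = only-cPath₃ ; sound = λ { (here refl) → cPath₃-isC } }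
    where
    only-cPath₃ : ∀ {r} → CPath 2 r → r ∈ cPath₃ ∷ []
    only-cPath₃ c with path₃-cases (proj₁ c)
    ... | inj₁ refl = ⊥-elim (>⇒≢ (n<1+n 2) (proj₁ (proj₂ c)))
    ... | inj₂ refl = here refl

-- censusFrom k lists the paths of each type of size k + 3.
censusFrom : ℕ → Census
censusFrom zero    = census₃
censusFrom (suc k) = next (suc (suc k)) (censusFrom k)

censusFrom-enumerated : ∀ k → Enumerated (suc (suc k)) (censusFrom k)
censusFrom-enumerated zero    = census₃-enumerated
censusFrom-enumerated (suc k) = next-enumerated (s≤s (s≤s z≤n)) (censusFrom-enumerated k)


-- Back to forward paths

module _ {A : Set} where

  all-reverse : ∀ {P : A → Set} {xs} → All P xs → All P (reverse xs)
  all-reverse pxs = All.tabulate (λ x∈ → All.lookup pxs (Any.reverse⁻ x∈))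

  all-reverse⁻ : ∀ {P : A → Set} {xs} → All P (reverse xs) → All P xs
  all-reverse⁻ pxs = All.tabulate (λ x∈ → All.lookup pxs (Any.reverse⁺ x∈))

  allPairs-reverse : ∀ {R : A → A → Set} xs → AllPairs (flip R) xs → AllPairs R (reverse xs)
  allPairs-reverse []       []          = []
  allPairs-reverse (x ∷ xs) (Rx ∷ Rxs) =
    subst (AllPairs _) (sym (List.unfold-reverse x xs))
      (AllPairs.++⁺ (allPairs-reverse xs Rxs) ([] ∷ []) (All.map (_∷ []) (all-reverse Rx)))

  allPairs-reverse⁻ : ∀ {R : A → A → Set} xs → AllPairs R (reverse xs) → AllPairs (flip R) xs
  allPairs-reverse⁻ {R} xs Rxs =
    subst (AllPairs (flip R)) (List.reverse-involutive xs) (allPairs-reverse {R = flip R} (reverse xs) Rxs)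

  reverse-≡-++ : ∀ {ss : List A} pre xs → reverse ss ≡ pre ++ xs → ss ≡ reverse xs ++ reverse pre
  reverse-≡-++ {ss} pre xs e = begin
    ss                          ≡⟨ List.reverse-involutive ss ⟨
    reverse (reverse ss)        ≡⟨ cong reverse e ⟩
    reverse (pre ++ xs)         ≡⟨ List.reverse-++ pre xs ⟩
    reverse xs ++ reverse pre   ∎
    where open ≡-Reasoning

reverse-∷∷ : ∀ {A : Set} (p q : A) r → reverse (p ∷ q ∷ r) ≡ reverse r ++ q ∷ p ∷ []
reverse-∷∷ p q r = begin
  reverse (p ∷ q ∷ r)        ≡⟨ List.unfold-reverse p (q ∷ r) ⟩
  reverse (q ∷ r) ∷ʳ p       ≡⟨ cong (_∷ʳ p) (List.unfold-reverse q r) ⟩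
  (reverse r ∷ʳ q) ∷ʳ p      ≡⟨ List.++-assoc (reverse r) (q ∷ []) (p ∷ []) ⟩
  reverse r ++ q ∷ p ∷ []    ∎
  where open ≡-Reasoning

module _ {A : Set} where

  reverse-reverse-++ : (xs ys : List A) → reverse (reverse xs ++ ys) ≡ reverse ys ++ xs
  reverse-reverse-++ xs ys =
    trans (List.reverse-++ (reverse xs) ys) (cong (reverse ys ++_) (List.reverse-involutive xs))

  ∷ʳ-nonEmpty : ∀ (ys : List A) a → ∃[ b ] ∃[ bs ] ys ∷ʳ a ≡ b ∷ bs
  ∷ʳ-nonEmpty []       a = a , [] , refl
  ∷ʳ-nonEmpty (b ∷ bs) a = b , bs ∷ʳ a , refl

  nonEmpty-∷ʳ : ∀ (b : A) bs → ∃[ as ] ∃[ a ] b ∷ bs ≡ as ∷ʳ a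
  nonEmpty-∷ʳ b []        = [] , b , refl
  nonEmpty-∷ʳ b (b′ ∷ bs) = let (as , a , e) = nonEmpty-∷ʳ b′ bs in b ∷ as , a , cong (b ∷_) e

coherent⇒allPairs : ∀ ss → Coherent ss → AllPairs Compatible ss
coherent⇒allPairs []       _   = []
coherent⇒allPairs (s ∷ ss) coh =
  All.tabulate (λ t∈ → let (mid , post , ss≡) = ∈.∈-∃++ t∈ in
                        coh [] mid post _ _ _ _ _ _ (cong (s ∷_) ss≡))
  ∷ coherent⇒allPairs ss
      (λ pre mid post i j a x y z ss≡ → coh (s ∷ pre) mid post i j a x y z (cong (s ∷_) ss≡))

allPairs⇒coherent : ∀ ss → AllPairs Compatible ss → Coherent ss
allPairs⇒coherent _ (compat ∷ _) [] mid post i j a x y z refl =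
  All.lookup compat (∈.∈-++⁺ʳ mid (here refl))
allPairs⇒coherent _ (_ ∷ coh) (_ ∷ pre) mid post i j a x y z refl =
  allPairs⇒coherent _ coh pre mid post i j a x y z refl

validMoves-∷ʳ⁺ : ∀ xs {q p} → ValidMoves (xs ++ q ∷ []) → ValidMove q p → ValidMoves (xs ++ q ∷ p ∷ [])
validMoves-∷ʳ⁺ []           _          q→p = q→p , tt
validMoves-∷ʳ⁺ (x ∷ [])     (x→q , _)  q→p = x→q , q→p , tt
validMoves-∷ʳ⁺ (x ∷ y ∷ xs) (x→y , vs) q→p = x→y , validMoves-∷ʳ⁺ (y ∷ xs) vs q→p

validMoves-∷ʳ⁻ : ∀ xs {q p} → ValidMoves (xs ++ q ∷ p ∷ []) → ValidMoves (xs ++ q ∷ []) × ValidMove q p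
validMoves-∷ʳ⁻ []           (q→p , _)       = tt , q→p
validMoves-∷ʳ⁻ (x ∷ [])     (x→q , q→p , _) = (x→q , tt) , q→p
validMoves-∷ʳ⁻ (x ∷ y ∷ xs) (x→y , vs)      = Product.map₁ (x→y ,_) (validMoves-∷ʳ⁻ (y ∷ xs) vs)

StartsAt21 : List Point → Set
StartsAt21 ps = ∃[ rest ] ps ≡ (2 , 1) ∷ rest

walk⇒validMoves : ∀ r → Walk r → StartsAt21 (reverse r) × ValidMoves (reverse r)
walk⇒validMoves (p ∷ [])    refl      = ([] , refl) , tt
walk⇒validMoves (p ∷ q ∷ r) (q→p , w) with walk⇒validMoves (q ∷ r) w
... | (rest , starts) , vs =
  (rest ∷ʳ p , trans (List.unfold-reverse p (q ∷ r)) (cong (_∷ʳ p) starts)) ,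
  subst ValidMoves (sym (reverse-∷∷ p q r))
    (validMoves-∷ʳ⁺ (reverse r) (subst ValidMoves (List.unfold-reverse q r) vs) q→p)

startsAt21-init : ∀ xs {x y} → StartsAt21 ((xs ∷ʳ x) ∷ʳ y) → StartsAt21 (xs ∷ʳ x)
startsAt21-init []       (_ , starts) = [] , cong (_∷ []) (List.∷-injectiveˡ starts)
startsAt21-init (a ∷ as) (_ , starts) = as ∷ʳ _ , cong (_∷ (as ∷ʳ _)) (List.∷-injectiveˡ starts)

validMoves⇒walk : ∀ r → StartsAt21 (reverse r) → ValidMoves (reverse r) → Walk r
validMoves⇒walk (p ∷ [])    (_ , starts) _ = List.∷-injectiveˡ starts
validMoves⇒walk (p ∷ q ∷ r) starts vs =
  proj₂ split ,
  validMoves⇒walk (q ∷ r)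
    (subst StartsAt21 (sym (List.unfold-reverse q r))
      (startsAt21-init (reverse r)
        (subst StartsAt21 (trans (List.unfold-reverse p (q ∷ r)) (cong (_∷ʳ p) (List.unfold-reverse q r)))
          starts)))
    (subst ValidMoves (sym (List.unfold-reverse q r)) (proj₁ split))
  where
  split = validMoves-∷ʳ⁻ (reverse r) (subst ValidMoves (reverse-∷∷ p q r) vs)

steps-∷ʳ : ∀ xs q p → steps (xs ++ q ∷ p ∷ []) ≡ steps (xs ++ q ∷ []) ∷ʳ enh q p
steps-∷ʳ []           q p = refl
steps-∷ʳ (x ∷ [])     q p = refl
steps-∷ʳ (x ∷ y ∷ xs) q p = cong (enh x y ∷_) (steps-∷ʳ (y ∷ xs) q p)

steps-reverse : ∀ r → steps (reverse r) ≡ reverse (walkSteps r)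
steps-reverse []          = refl
steps-reverse (p ∷ [])    = refl
steps-reverse (p ∷ q ∷ r) = begin
  steps (reverse (p ∷ q ∷ r))                 ≡⟨ cong steps (reverse-∷∷ p q r) ⟩
  steps (reverse r ++ q ∷ p ∷ [])             ≡⟨ steps-∷ʳ (reverse r) q p ⟩
  steps (reverse r ∷ʳ q) ∷ʳ enh q p           ≡⟨ cong (λ ps → steps ps ∷ʳ enh q p) (List.unfold-reverse q r) ⟨
  steps (reverse (q ∷ r)) ∷ʳ enh q p          ≡⟨ cong (_∷ʳ enh q p) (steps-reverse (q ∷ r)) ⟩
  reverse (walkSteps (q ∷ r)) ∷ʳ enh q p      ≡⟨ List.unfold-reverse (enh q p) (walkSteps (q ∷ r)) ⟨
  reverse (walkSteps (p ∷ q ∷ r))             ∎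
  where open ≡-Reasoning

walk-validPoints : ∀ {m r} → Walk r → EndsAt m r → All OffDiagonal r → All (ValidPoint (suc m)) r
walk-validPoints {m} {l ∷ r} w (o , refl) off =
  All.zipWith (λ ((2≤x , 1≤y) , (x≤ , y≤) , x≢y) → (≤-trans (s≤s z≤n) 2≤x , x≤) , (1≤y , y≤) , x≢y)
    (walk-≥ w , All.zipWith (λ x → x) (All.map (λ p≤ → ≤P-trans p≤ (≤-pt o (n≤1+n m) ≤-refl)) (walk-≤ w) ,
                                       off))

coherentLatticePath⇒path : ∀ {m} r → CoherentLatticePath (suc m) (reverse r) → Path m r
coherentLatticePath⇒path {m} r ((starts , (ini , ℓ , r≡ , ℓ-end) , valid , vs) , coh) =
  (validMoves⇒walk r starts vs , All.map (proj₂ ∘ proj₂) (all-reverse⁻ valid) ,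
   allPairs-reverse⁻ (walkSteps r)
     (subst (AllPairs Compatible) (steps-reverse r) (coherent⇒allPairs _ coh))) ,
  subst (EndsAt m) (sym (reverse-≡-++ ini (ℓ ∷ []) r≡)) (endpoint ℓ-end)
  where
  endpoint : ℓ ≡ (m , suc m) ⊎ ℓ ≡ (suc m , m) → ∃[ o ] ℓ ≡ pt o m (suc m)
  endpoint (inj₁ ℓ≡) = true , ℓ≡
  endpoint (inj₂ ℓ≡) = false , ℓ≡

path⇒coherentLatticePath : ∀ {m} r → Path m r → CoherentLatticePath (suc m) (reverse r)
path⇒coherentLatticePath {m} (l ∷ r) ((w , off , coh) , o , refl) =
  (proj₁ walk′ , (reverse r , l , List.unfold-reverse l r , endpoint o) ,
   all-reverse (walk-validPoints w (o , refl) off) , proj₂ walk′) ,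
  allPairs⇒coherent _
    (subst (AllPairs Compatible) (sym (steps-reverse (l ∷ r))) (allPairs-reverse (walkSteps (l ∷ r)) coh))
  where
  walk′ = walk⇒validMoves (l ∷ r) w
  endpoint : ∀ o → pt o m (suc m) ≡ (m , suc m) ⊎ pt o m (suc m) ≡ (suc m , m)
  endpoint true  = inj₁ refl
  endpoint false = inj₂ refl

endsT⇒ : ∀ {m} ss → EndsT m ss → ∃[ pre ] ∃[ x ] reverse ss ≡ pre ++ (x , suc m , m) ∷ []
endsT⇒ (s ∷ ss) (tgt≡ , fix≡) =
  reverse ss , src s , trans (List.unfold-reverse s ss) (cong (λ t → reverse ss ∷ʳ t) (tgt,fix⇒≡ s tgt≡ fix≡))

endsT⇐ : ∀ {m} ss pre x → reverse ss ≡ pre ++ (x , suc m , m) ∷ [] → EndsT m ss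
endsT⇐ {m} ss pre x e = subst (EndsT m) (sym (reverse-≡-++ pre _ e)) (refl , refl)

endsC⇒ : ∀ {m} ss → EndsC m ss →
         ∃[ pre ] ∃[ x ] ∃[ y ] reverse ss ≡ pre ++ (x , suc m , y) ∷ (y , m , suc m) ∷ []
endsC⇒ (s ∷ s′ ∷ ss) (tgt≡ , fix≡ , tgt′≡ , fix′≡) =
  reverse ss , src s′ , src s ,
  trans (reverse-∷∷ s s′ ss)
    (cong₂ (λ t t′ → reverse ss ++ t′ ∷ t ∷ []) (tgt,fix⇒≡ s tgt≡ fix≡)
                                                (tgt,fix⇒≡ s′ tgt′≡ fix′≡))

endsC⇐ : ∀ {m} ss pre x y → reverse ss ≡ pre ++ (x , suc m , y) ∷ (y , m , suc m) ∷ [] → EndsC m ss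
endsC⇐ {m} ss pre x y e = subst (EndsC m) (sym (reverse-≡-++ pre _ e)) (refl , refl , refl , refl)

reverse-chain-∷ʳ : ∀ z y ys e e′ →
                   reverse (chain z (y ∷ ys ∷ʳ e) e′) ≡ (e , e′ , z) ∷ reverse (chain z (y ∷ ys) e)
reverse-chain-∷ʳ z y ys e e′ =
  trans (cong reverse (sym (chain-∷ʳ y ys))) (List.reverse-++ (chain z (y ∷ ys) e) ((e , e′ , z) ∷ []))
  where
  chain-∷ʳ : ∀ y ys → chain z (y ∷ ys) e ∷ʳ (e , e′ , z) ≡ chain z (y ∷ ys ∷ʳ e) e′
  chain-∷ʳ y []        = refl
  chain-∷ʳ y (y′ ∷ ys) = cong ((y , y′ , z) ∷_) (chain-∷ʳ y′ ys)

runs⇒chain : ∀ {n e} ss → Runs n e ss →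
             ∃[ y ] ∃[ ys ] ∃[ x ] ∃[ rest ] ss ≡ reverse (chain n (y ∷ ys) e) ++ (x , n , y) ∷ rest
runs⇒chain (s ∷ s′ ∷ rest) (tgt≡ , fix≡ , inj₁ (tgt′≡ , fix′≡)) =
  src s , [] , src s′ , rest , cong₂ _∷_ (tgt,fix⇒≡ s tgt≡ fix≡) (cong (_∷ rest) (tgt,fix⇒≡ s′ tgt′≡ fix′≡))
runs⇒chain {n} {e} (s ∷ ss) (tgt≡ , fix≡ , inj₂ runs) with runs⇒chain ss runs
... | y , ys , x , rest , ss≡ = y , ys ∷ʳ src s , x , rest , (begin
  s ∷ ss
    ≡⟨ cong₂ _∷_ (tgt,fix⇒≡ s tgt≡ fix≡) ss≡ ⟩
  (src s , e , n) ∷ reverse (chain n (y ∷ ys) (src s)) ++ (x , n , y) ∷ rest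
    ≡⟨ cong (_++ (x , n , y) ∷ rest) (reverse-chain-∷ʳ n y ys (src s) e) ⟨
  reverse (chain n (y ∷ ys ∷ʳ src s) e) ++ (x , n , y) ∷ rest
    ∎)
  where open ≡-Reasoning

lineEntry⇒runs : ∀ {n e} ys {a ss} → LineEntry n a ss → Runs n e (reverse (chain n (a ∷ ys) e) ++ ss)
lineEntry⇒runs []                   entry = refl , refl , entry
lineEntry⇒runs {n} {e} (b ∷ ys) {a} {ss} entry =
  subst (Runs n e) shift (lineEntry⇒runs ys (inj₂ (refl , refl , entry)))
  where
  shift : reverse (chain n (b ∷ ys) e) ++ (a , b , n) ∷ ss ≡ reverse (chain n (a ∷ b ∷ ys) e) ++ ss
  shift = trans (sym (List.++-assoc (reverse (chain n (b ∷ ys) e)) ((a , b , n) ∷ []) ss))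
                (cong (_++ ss) (sym (List.unfold-reverse (a , b , n) (chain n (b ∷ ys) e))))

endsQ⇒ : ∀ {m} ss → EndsQ m ss →
         ∃[ pre ] ∃[ x ] ∃[ y₁ ] ∃[ y₂ ] ∃[ ys ]
           reverse ss ≡ pre ++ (x , suc m , y₁) ∷ chain (suc m) (y₁ ∷ y₂ ∷ ys) m
endsQ⇒ {m} (s ∷ ss) (tgt≡ , fix≡ , runs) with runs⇒chain ss runs
... | y , ys , x , rest , ss≡ with ∷ʳ-nonEmpty ys (src s)
...   | y₂ , ys′ , ys≡ = reverse rest , x , y , y₂ , ys′ , (begin
  reverse (s ∷ ss)
    ≡⟨ cong reverse s∷ss≡ ⟩
  reverse (reverse C ++ (x , suc m , y) ∷ rest)
    ≡⟨ reverse-reverse-++ C ((x , suc m , y) ∷ rest) ⟩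
  reverse ((x , suc m , y) ∷ rest) ++ C
    ≡⟨ cong (_++ C) (List.unfold-reverse _ rest) ⟩
  (reverse rest ∷ʳ (x , suc m , y)) ++ C
    ≡⟨ List.++-assoc (reverse rest) _ C ⟩
  reverse rest ++ (x , suc m , y) ∷ C
    ∎)
  where
  open ≡-Reasoning
  C = chain (suc m) (y ∷ y₂ ∷ ys′) m
  s∷ss≡ : s ∷ ss ≡ reverse C ++ (x , suc m , y) ∷ rest
  s∷ss≡ = begin
    s ∷ ss
      ≡⟨ cong₂ _∷_ (tgt,fix⇒≡ s tgt≡ fix≡) ss≡ ⟩
    (src s , m , suc m) ∷ reverse (chain (suc m) (y ∷ ys) (src s)) ++ (x , suc m , y) ∷ rest
      ≡⟨ cong (_++ _) (reverse-chain-∷ʳ (suc m) y ys (src s) m) ⟨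
    reverse (chain (suc m) (y ∷ ys ∷ʳ src s) m) ++ (x , suc m , y) ∷ rest
      ≡⟨ cong (λ zs → reverse (chain (suc m) (y ∷ zs) m) ++ _) ys≡ ⟩
    reverse C ++ (x , suc m , y) ∷ rest
      ∎

endsQ⇐ : ∀ {m} ss pre x y₁ y₂ ys → reverse ss ≡ pre ++ (x , suc m , y₁) ∷ chain (suc m) (y₁ ∷ y₂ ∷ ys) m →
         EndsQ m ss
endsQ⇐ {m} ss pre x y₁ y₂ ys e with nonEmpty-∷ʳ y₂ ys
... | zs , z , ys≡ = subst (EndsQ m) (sym ss≡) (refl , refl , lineEntry⇒runs zs (inj₁ (refl , refl)))
  where
  open ≡-Reasoning
  C = chain (suc m) (y₁ ∷ y₂ ∷ ys) m
  ss≡ : ss ≡ (z , m , suc m) ∷ reverse (chain (suc m) (y₁ ∷ zs) z) ++ (x , suc m , y₁) ∷ reverse pre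
  ss≡ = begin
    ss
      ≡⟨ reverse-≡-++ pre _ e ⟩
    reverse ((x , suc m , y₁) ∷ C) ++ reverse pre
      ≡⟨ cong (_++ reverse pre) (List.unfold-reverse _ C) ⟩
    (reverse C ∷ʳ (x , suc m , y₁)) ++ reverse pre
      ≡⟨ List.++-assoc (reverse C) _ _ ⟩
    reverse C ++ (x , suc m , y₁) ∷ reverse pre
      ≡⟨ cong (λ zs′ → reverse (chain (suc m) (y₁ ∷ zs′) m) ++ _) ys≡ ⟩
    reverse (chain (suc m) (y₁ ∷ zs ∷ʳ z) m) ++ (x , suc m , y₁) ∷ reverse pre
      ≡⟨ cong (_++ _) (reverse-chain-∷ʳ (suc m) y₁ zs z m) ⟩
    (z , m , suc m) ∷ reverse (chain (suc m) (y₁ ∷ zs) z) ++ (x , suc m , y₁) ∷ reverse pre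
      ∎

tPath⇒isT : ∀ {m} r → TPath m r → IsT (suc m) (reverse r)
tPath⇒isT r (path , endsT) =
  path⇒coherentLatticePath r path ,
  (let (pre , x , e) = endsT⇒ (walkSteps r) endsT in pre , x , trans (steps-reverse r) e)

isT⇒tPath : ∀ {m} r → IsT (suc m) (reverse r) → TPath m r
isT⇒tPath r (clp , pre , x , e) =
  coherentLatticePath⇒path r clp , endsT⇐ (walkSteps r) pre x (trans (sym (steps-reverse r)) e)

cPath⇒isC : ∀ {m} r → CPath m r → IsC (suc m) (reverse r)
cPath⇒isC r (path , endsC) =
  path⇒coherentLatticePath r path ,
  (let (pre , x , y , e) = endsC⇒ (walkSteps r) endsC in pre , x , y , trans (steps-reverse r) e)

isC⇒cPath : ∀ {m} r → IsC (suc m) (reverse r) → CPath m r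
isC⇒cPath r (clp , pre , x , y , e) =
  coherentLatticePath⇒path r clp , endsC⇐ (walkSteps r) pre x y (trans (sym (steps-reverse r)) e)

qPath⇒isQ : ∀ {m} r → QPath m r → IsQ (suc m) (reverse r)
qPath⇒isQ r (path , endsQ) =
  path⇒coherentLatticePath r path ,
  (let (pre , x , y₁ , y₂ , ys , e) = endsQ⇒ (walkSteps r) endsQ
   in pre , x , y₁ , y₂ , ys , trans (steps-reverse r) e)

isQ⇒qPath : ∀ {m} r → IsQ (suc m) (reverse r) → QPath m r
isQ⇒qPath r (clp , pre , x , y₁ , y₂ , ys , e) =
  coherentLatticePath⇒path r clp , endsQ⇐ (walkSteps r) pre x y₁ y₂ ys (trans (sym (steps-reverse r)) e)

hasCount-reverse : ∀ {A : Set} {P Q : List A → Set} {L} → (∀ r → Q r → P (reverse r)) →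
                   (∀ r → P (reverse r) → Q r) → Enumerates Q L → HasCount P (length L)
hasCount-reverse {P = P} {L = L} Q⇒P P⇒Q e =
  subst (HasCount P) (List.length-map reverse L)
    (enumerates⇒hasCount (enumerates-cong (image⊆ (Q⇒P _)) from-reverse
      (enumerates-map (λ _ _ → List.reverse-injective) e)))
  where
  from-reverse : ∀ {ps} → P ps → Image reverse _ ps
  from-reverse {ps} p =
    reverse ps , P⇒Q (reverse ps) (subst P (sym (List.reverse-involutive ps)) p) , List.reverse-involutive ps


length-map-++ : ∀ {A B : Set} (f : A → B) xs ys → length (map f xs ++ ys) ≡ length xs + length ys
length-map-++ f xs ys = trans (List.length-++ (map f xs)) (cong (_+ length ys) (List.length-map f xs))

module _ (m : ℕ) (ts qs cs : List (List Point)) where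
  private
    t = length ts
    q = length qs
    c = length cs

  length-tPaths-next : length (tPaths (next m (census ts qs cs))) ≡ t + 2 * q + 2 * c
  length-tPaths-next = begin
    length (map toT₁ (ts ++ qs ++ cs) ++ map toT₂ (qs ++ cs))
      ≡⟨ length-map-++ toT₁ (ts ++ qs ++ cs) _ ⟩
    length (ts ++ qs ++ cs) + length (map toT₂ (qs ++ cs))
      ≡⟨ cong₂ _+_ (List.length-++ ts) (List.length-map toT₂ (qs ++ cs)) ⟩
    t + length (qs ++ cs) + length (qs ++ cs)
      ≡⟨ cong (λ n → t + n + n) (List.length-++ qs) ⟩
    t + (q + c) + (q + c)
      ≡⟨ row t q c ⟩
    t + 2 * q + 2 * c
      ∎
    where
    open ≡-Reasoning
    row : ∀ t q c → t + (q + c) + (q + c) ≡ t + 2 * q + 2 * c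
    row = solve-∀

  length-qPaths-next : length (qPaths (next m (census ts qs cs))) ≡ 2 * q + c
  length-qPaths-next = begin
    length (map (toQ₁ m) (qs ++ cs) ++ map (toQ₂ m) qs)
      ≡⟨ length-map-++ (toQ₁ m) (qs ++ cs) _ ⟩
    length (qs ++ cs) + length (map (toQ₂ m) qs)
      ≡⟨ cong₂ _+_ (List.length-++ qs) (List.length-map (toQ₂ m) qs) ⟩
    q + c + q
      ≡⟨ row q c ⟩
    2 * q + c
      ∎
    where
    open ≡-Reasoning
    row : ∀ q c → q + c + q ≡ 2 * q + c
    row = solve-∀

  length-cPaths-next : length (cPaths (next m (census ts qs cs))) ≡ 2 * t + 2 * c
  length-cPaths-next = begin
    length (map (toC₁ m) ts ++ map (toC₂ m) ts ++ map (toC₃ m) cs ++ map (toC₄ m) cs)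
      ≡⟨ length-map-++ (toC₁ m) ts _ ⟩
    t + length (map (toC₂ m) ts ++ map (toC₃ m) cs ++ map (toC₄ m) cs)
      ≡⟨ cong (t +_) (length-map-++ (toC₂ m) ts _) ⟩
    t + (t + length (map (toC₃ m) cs ++ map (toC₄ m) cs))
      ≡⟨ cong (λ n → t + (t + n)) (length-map-++ (toC₃ m) cs _) ⟩
    t + (t + (c + length (map (toC₄ m) cs)))
      ≡⟨ cong (λ n → t + (t + (c + n))) (List.length-map (toC₄ m) cs) ⟩
    t + (t + (c + c))
      ≡⟨ row t c ⟩
    2 * t + 2 * c
      ∎
    where
    open ≡-Reasoning
    row : ∀ t c → t + (t + (c + c)) ≡ 2 * t + 2 * c
    row = solve-∀

tCount qCount cCount : ℕ → ℕ
tCount n = length (tPaths (censusFrom (n ∸ 3)))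
qCount n = length (qPaths (censusFrom (n ∸ 3)))
cCount n = length (cPaths (censusFrom (n ∸ 3)))

counts-correct : ∀ n → 3 ≤ n →
                 HasCount (IsT n) (tCount n) × HasCount (IsQ n) (qCount n) × HasCount (IsC n) (cCount n)
counts-correct (suc (suc (suc k))) (s≤s (s≤s (s≤s _))) with censusFrom-enumerated k
... | eT , eQ , eC =
  hasCount-reverse tPath⇒isT isT⇒tPath eT ,
  hasCount-reverse qPath⇒isQ isQ⇒qPath eQ ,
  hasCount-reverse cPath⇒isC isC⇒cPath eC

counts-recurrence : ∀ n → 3 ≤ n →
                    tCount (n + 1) ≡ tCount n + 2 * qCount n + 2 * cCount n ×
                    qCount (n + 1) ≡ 2 * qCount n + cCount n ×
                    cCount (n + 1) ≡ 2 * tCount n + 2 * cCount n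
counts-recurrence (suc (suc (suc k))) (s≤s (s≤s (s≤s _))) rewrite +-comm k 1 with censusFrom k
... | census ts qs cs =
  length-tPaths-next (suc (suc k)) ts qs cs ,
  length-qPaths-next (suc (suc k)) ts qs cs ,
  length-cPaths-next (suc (suc k)) ts qs cs

proposition5p1 : Σ[ t ∈ (ℕ → ℕ) ] Σ[ q ∈ (ℕ → ℕ) ] Σ[ c ∈ (ℕ → ℕ) ]
    ((∀ (n : ℕ) → 4 ≤ n → HasCount (IsT n) (t n) × HasCount (IsQ n) (q n) × HasCount (IsC n) (c n))
    × (t 4 ≡ 3 × q 4 ≡ 1 × c 4 ≡ 4)
    × (∀ (n : ℕ) → 4 ≤ n →
         t (n + 1) ≡ t n + 2 * q n + 2 * c n
         × q (n + 1) ≡ 2 * q n + c n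
         × c (n + 1) ≡ 2 * t n + 2 * c n))
proposition5p1 =
  tCount , qCount , cCount ,
  (λ n 4≤n → counts-correct n (≤-trans (n≤1+n 3) 4≤n)) ,
  (refl , refl , refl) ,
  (λ n 4≤n → counts-recurrence n (≤-trans (n≤1+n 3) 4≤n))
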